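{- For every composite number $n$, the distance characteristic polynomial of the strong power graph $\mathcal{P}_s(\mathbb{Z}_n)$ is $$\Theta(\mathcal{P}_s(\mathbb{Z}_n),x)=(x+1)^{n-3}\Big(x^3+(3-n)x^2+(3-2n-3\phi(n))x-\phi(n)^2-\phi(n)(4-n)-n+1\Big),$$ where $\phi$ is Euler's totient function.
   Context: For a finite group $G$ of order $n$, the strong power graph $\mathcal{P}_s(G)$ is the simple graph with vertex set $G$ in which two distinct vertices $x,y$ are adjacent if and only if $x^{n_1}=y^{n_2}$ for some positive integers $n_1,n_2<n$. $\mathbb{Z}_n=\{0,1,\ldots,n-1\}$ is the cyclic group of order $n$ under addition modulo $n$ (so $x^{n_1}$ means $n_1x$). For a connected graph $\Gamma$ with vertices $v_1,\dots,v_n$, the distance matrix $D(\Gamma)$ is the $n\times n$ matrix whose $(i,j)$ entry is the graph distance between $v_i$ and $v_j$, and $\Theta(\Gamma,x)=\det(xI-D(\Gamma))$ is its distance characteristic polynomial. -}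

module Defs where

open import Data.Nat as ℕ using (ℕ; zero; suc; _<_; _≤_)
open import Data.Nat.GCD using (gcd)
open import Data.Integer as ℤ using (ℤ; +_)
open import Data.Integer.Divisibility using () renaming (_∣_ to _∣ℤ_)
open import Data.Fin using (Fin; toℕ; punchIn; _≟_)
import Data.Fin as F
open import Data.List using (List; []; _∷_; map; length; filter; upTo)
open import Data.Product using (Σ; _×_)
open import Relation.Binary.PropositionalEquality using (_≡_; _≢_)
open import Relation.Nullary.Decidable using (⌊_⌋)
open import Data.Bool using (if_then_else_)

φ : ℕ → ℕ
φ n = length (filter (λ k → gcd k n ℕ.≟ 1) (map suc (upTo n)))

StrongPowerAdj : (n : ℕ) → Fin n → Fin n → Set
StrongPowerAdj n x y =
  x ≢ y ×
  Σ ℕ λ n₁ → Σ ℕ λ n₂ →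
    (1 ≤ n₁) × (n₁ < n) × (1 ≤ n₂) × (n₂ < n) ×
    ((+ n) ∣ℤ ((+ (n₁ ℕ.* toℕ x)) ℤ.- (+ (n₂ ℕ.* toℕ y))))

data Walk {n : ℕ} (Adj : Fin n → Fin n → Set) : Fin n → Fin n → ℕ → Set where
  here  : ∀ {u} → Walk Adj u u 0
  step  : ∀ {u w v k} → Adj u w → Walk Adj w v k → Walk Adj u v (suc k)

IsDistance : {n : ℕ} → (Fin n → Fin n → Set) → (Fin n → Fin n → ℕ) → Set
IsDistance Adj d =
  ∀ u v → Walk Adj u v (d u v) × (∀ k → Walk Adj u v k → d u v ≤ k)

-- Polynomials over ℤ as little-endian coefficient lists

Poly : Set
Poly = List ℤ

infixl 6 _+ₚ_ _-ₚ_
infixl 7 _*ₚ_ _·ₚ_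

_+ₚ_ : Poly → Poly → Poly
[]       +ₚ q        = q
(a ∷ p)  +ₚ []       = a ∷ p
(a ∷ p)  +ₚ (b ∷ q)  = (a ℤ.+ b) ∷ (p +ₚ q)

-ₚ_ : Poly → Poly
-ₚ p = map ℤ.-_ p

_-ₚ_ : Poly → Poly → Poly
p -ₚ q = p +ₚ (-ₚ q)

_·ₚ_ : ℤ → Poly → Poly
a ·ₚ p = map (a ℤ.*_) p

_*ₚ_ : Poly → Poly → Poly
[]      *ₚ q = []
(a ∷ p) *ₚ q = (a ·ₚ q) +ₚ (+ 0 ∷ (p *ₚ q))

const : ℤ → Poly
const a = a ∷ []

X : Poly
X = + 0 ∷ + 1 ∷ []

_^ₚ_ : Poly → ℕ → Poly
p ^ₚ zero  = const (+ 1)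
p ^ₚ suc k = p *ₚ (p ^ₚ k)

coeff : Poly → ℕ → ℤ
coeff []      _       = + 0
coeff (a ∷ p) zero    = a
coeff (a ∷ p) (suc i) = coeff p i

infix 4 _≈ₚ_
_≈ₚ_ : Poly → Poly → Set
p ≈ₚ q = ∀ i → coeff p i ≡ coeff q i

sumFin : (m : ℕ) → (Fin m → Poly) → Poly
sumFin zero    f = []
sumFin (suc m) f = f F.zero +ₚ sumFin m (λ j → f (F.suc j))

sign : ℕ → ℤ
sign zero          = + 1
sign (suc zero)    = ℤ.-[1+ 0 ]
sign (suc (suc k)) = sign k

minor : {m : ℕ} → (Fin (suc m) → Fin (suc m) → Poly) → Fin (suc m) → Fin m → Fin m → Poly
minor M j r c = M (F.suc r) (punchIn j c)

det : (m : ℕ) → (Fin m → Fin m → Poly) → Poly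
det zero    M = const (+ 1)
det (suc m) M = sumFin (suc m) (λ j → sign (toℕ j) ·ₚ (M F.zero j *ₚ det m (minor M j)))

distCharPoly : (m : ℕ) → (Fin m → Fin m → ℕ) → Poly
distCharPoly m d = det m (λ i j → (if ⌊ i ≟ j ⌋ then X else []) -ₚ const (+ d i j))

module Submission where

open import Defs
open import Data.Nat using (ℕ; _∸_)
open import Data.Nat.Primality using (Composite)
open import Data.Integer using (+_; -_; _+_; _-_; _*_)
open import Data.Fin using (Fin)

-- Put a = x + 1. Then xI − D = a·I + W, where W has −1 on the diagonal and minus the distance elsewhere,
-- and W_ij depends only on the kinds of i and j: the identity 0, the φ(n) generators, or the other elements.
-- Distinct nonzero x, y are always adjacent (y·x = x·y); 0 is adjacent to a nonzero non-generator y (killed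
-- by n / gcd(y, n)) but to no generator, and reaches each generator through a proper divisor p of n.
-- Expanding det(a·I + W) by linearity in the columns gives Σ_S a^(n − |S|) det W_S over principal minors;
-- a minor on two vertices of the same kind has two equal columns and vanishes, and the remaining ones sum to
-- a^n − n a^(n−1) − 3φ a^(n−2) + φ (n − 1 − φ) a^(n−3), which is the stated polynomial.

module Polynomial where

  open import Data.Nat as ℕ using (zero; suc)
  open import Data.Integer as ℤ using (ℤ; +_; -_)
  import Data.Integer.Properties as ℤP
  open import Data.Integer.Tactic.RingSolver using (solve-∀)
  open import Data.List using ([]; _∷_)
  open import Data.Maybe using (Maybe; just; nothing)
  open import Data.Product using (_,_)
  open import Relation.Nullary using (yes; no)
  open import Relation.Binary.PropositionalEquality using (_≡_; refl; sym; trans; cong; cong₂)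
  open import Relation.Binary.Structures using (IsEquivalence)
  open import Relation.Binary.Bundles using (Setoid)
  import Relation.Binary.Reasoning.Setoid
  open import Algebra.Structures using (IsCommutativeRing)
  open import Algebra.Bundles using (CommutativeRing; RawRing)
  open import Algebra.Solver.Ring.AlmostCommutativeRing
    using (AlmostCommutativeRing; fromCommutativeRing; _-Raw-AlmostCommutative⟶_)

  -- _≈ₚ_ wrapped in a record, so that both polynomials can be recovered by unification.
  infix 4 _≈_
  record _≈_ (p q : Poly) : Set where
    constructor coeffwise
    field coeff-≡ : ∀ i → coeff p i ≡ coeff q i
  open _≈_ public

  ≈-refl : ∀ {p} → p ≈ p
  ≈-refl = coeffwise λ _ → refl

  ≈-reflexive : ∀ {p q} → p ≡ q → p ≈ q
  ≈-reflexive refl = ≈-refl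

  ≈-sym : ∀ {p q} → p ≈ q → q ≈ p
  ≈-sym e = coeffwise λ i → sym (coeff-≡ e i)

  ≈-trans : ∀ {p q r} → p ≈ q → q ≈ r → p ≈ r
  ≈-trans e f = coeffwise λ i → trans (coeff-≡ e i) (coeff-≡ f i)

  ≈-isEquivalence : IsEquivalence _≈_
  ≈-isEquivalence = record { refl = ≈-refl ; sym = ≈-sym ; trans = ≈-trans }

  setoid : Setoid _ _
  setoid = record { isEquivalence = ≈-isEquivalence }

  module ≈-Reasoning = Relation.Binary.Reasoning.Setoid setoid

  ∷-cong : ∀ {a b p q} → a ≡ b → p ≈ q → (a ∷ p) ≈ (b ∷ q)
  ∷-cong e f = coeffwise λ { zero → e ; (suc i) → coeff-≡ f i }

  coeff-+ : ∀ p q i → coeff (p +ₚ q) i ≡ coeff p i ℤ.+ coeff q i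
  coeff-+ []      q       i       = sym (ℤP.+-identityˡ _)
  coeff-+ (a ∷ p) []      i       = sym (ℤP.+-identityʳ _)
  coeff-+ (a ∷ p) (b ∷ q) zero    = refl
  coeff-+ (a ∷ p) (b ∷ q) (suc i) = coeff-+ p q i

  coeff-· : ∀ a p i → coeff (a ·ₚ p) i ≡ a ℤ.* coeff p i
  coeff-· a []      i       = sym (ℤP.*-zeroʳ a)
  coeff-· a (b ∷ p) zero    = refl
  coeff-· a (b ∷ p) (suc i) = coeff-· a p i

  coeff-neg : ∀ p i → coeff (-ₚ p) i ≡ - coeff p i
  coeff-neg []      i       = refl
  coeff-neg (b ∷ p) zero    = refl
  coeff-neg (b ∷ p) (suc i) = coeff-neg p i

  +-cong : ∀ {p p′ q q′} → p ≈ p′ → q ≈ q′ → (p +ₚ q) ≈ (p′ +ₚ q′)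
  +-cong {p} {p′} {q} {q′} e f = coeffwise λ i →
    trans (coeff-+ p q i) (trans (cong₂ ℤ._+_ (coeff-≡ e i) (coeff-≡ f i)) (sym (coeff-+ p′ q′ i)))

  ·-congʳ : ∀ a {p q} → p ≈ q → (a ·ₚ p) ≈ (a ·ₚ q)
  ·-congʳ a {p} {q} e = coeffwise λ i →
    trans (coeff-· a p i) (trans (cong (a ℤ.*_) (coeff-≡ e i)) (sym (coeff-· a q i)))

  ·-congˡ : ∀ {a b} p → a ≡ b → (a ·ₚ p) ≈ (b ·ₚ p)
  ·-congˡ p refl = ≈-refl

  neg-cong : ∀ {p q} → p ≈ q → (-ₚ p) ≈ (-ₚ q)
  neg-cong {p} {q} e = coeffwise λ i →
    trans (coeff-neg p i) (trans (cong -_ (coeff-≡ e i)) (sym (coeff-neg q i)))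

  +-comm : ∀ p q → (p +ₚ q) ≈ (q +ₚ p)
  +-comm p q = coeffwise λ i →
    trans (coeff-+ p q i) (trans (ℤP.+-comm (coeff p i) _) (sym (coeff-+ q p i)))

  +-assoc : ∀ p q r → ((p +ₚ q) +ₚ r) ≈ (p +ₚ (q +ₚ r))
  +-assoc p q r = coeffwise λ i →
    trans (coeff-+ (p +ₚ q) r i) (trans (cong (λ z → z ℤ.+ coeff r i) (coeff-+ p q i))
      (trans (ℤP.+-assoc (coeff p i) _ _)
      (trans (cong (λ z → coeff p i ℤ.+ z) (sym (coeff-+ q r i))) (sym (coeff-+ p (q +ₚ r) i)))))

  +-identityˡ : ∀ p → ([] +ₚ p) ≈ p
  +-identityˡ p = ≈-refl

  +-identityʳ : ∀ p → (p +ₚ []) ≈ p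
  +-identityʳ []      = ≈-refl
  +-identityʳ (a ∷ p) = ≈-refl

  +-inverseʳ : ∀ p → (p +ₚ (-ₚ p)) ≈ []
  +-inverseʳ p = coeffwise λ i →
    trans (coeff-+ p (-ₚ p) i) (trans (cong (λ z → coeff p i ℤ.+ z) (coeff-neg p i)) (ℤP.+-inverseʳ (coeff p i)))

  +-inverseˡ : ∀ p → ((-ₚ p) +ₚ p) ≈ []
  +-inverseˡ p = ≈-trans (+-comm (-ₚ p) p) (+-inverseʳ p)

  +-interchange : ∀ p q r s → ((p +ₚ q) +ₚ (r +ₚ s)) ≈ ((p +ₚ r) +ₚ (q +ₚ s))
  +-interchange p q r s = coeffwise λ i →
    trans (coeff-+ (p +ₚ q) (r +ₚ s) i) (trans (cong₂ ℤ._+_ (coeff-+ p q i) (coeff-+ r s i))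
      (trans (interchange (coeff p i) (coeff q i) (coeff r i) (coeff s i))
      (sym (trans (coeff-+ (p +ₚ r) (q +ₚ s) i) (cong₂ ℤ._+_ (coeff-+ p r i) (coeff-+ q s i))))))
    where
    interchange : ∀ a b c d → (a ℤ.+ b) ℤ.+ (c ℤ.+ d) ≡ (a ℤ.+ c) ℤ.+ (b ℤ.+ d)
    interchange = solve-∀

  ·-distribˡ-+ : ∀ a p q → (a ·ₚ (p +ₚ q)) ≈ ((a ·ₚ p) +ₚ (a ·ₚ q))
  ·-distribˡ-+ a p q = coeffwise λ i →
    trans (coeff-· a (p +ₚ q) i) (trans (cong (a ℤ.*_) (coeff-+ p q i))
      (trans (ℤP.*-distribˡ-+ a (coeff p i) _)
      (sym (trans (coeff-+ (a ·ₚ p) (a ·ₚ q) i) (cong₂ ℤ._+_ (coeff-· a p i) (coeff-· a q i))))))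

  ·-distribʳ-+ : ∀ a b p → ((a ℤ.+ b) ·ₚ p) ≈ ((a ·ₚ p) +ₚ (b ·ₚ p))
  ·-distribʳ-+ a b p = coeffwise λ i →
    trans (coeff-· (a ℤ.+ b) p i) (trans (ℤP.*-distribʳ-+ (coeff p i) a b)
      (sym (trans (coeff-+ (a ·ₚ p) (b ·ₚ p) i) (cong₂ ℤ._+_ (coeff-· a p i) (coeff-· b p i)))))

  ·-assoc : ∀ a b p → (a ·ₚ (b ·ₚ p)) ≈ ((a ℤ.* b) ·ₚ p)
  ·-assoc a b p = coeffwise λ i →
    trans (coeff-· a (b ·ₚ p) i) (trans (cong (a ℤ.*_) (coeff-· b p i))
      (trans (sym (ℤP.*-assoc a b _)) (sym (coeff-· (a ℤ.* b) p i))))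

  ·-zeroˡ : ∀ p → (+ 0 ·ₚ p) ≈ []
  ·-zeroˡ p = coeffwise λ i → trans (coeff-· (+ 0) p i) (ℤP.*-zeroˡ (coeff p i))

  ·-identityˡ : ∀ p → (+ 1 ·ₚ p) ≈ p
  ·-identityˡ p = coeffwise λ i → trans (coeff-· (+ 1) p i) (ℤP.*-identityˡ (coeff p i))

  *-zeroˡ : ∀ {p} q → p ≈ [] → (p *ₚ q) ≈ []
  *-zeroˡ {[]}    q e = ≈-refl
  *-zeroˡ {a ∷ p} q e =
    ≈-trans (+-cong (≈-trans (·-congˡ q (coeff-≡ e zero)) (·-zeroˡ q))
                    (∷-cong refl (*-zeroˡ {p} q (coeffwise λ i → coeff-≡ e (suc i)))))
            (coeffwise λ { zero → refl ; (suc i) → refl })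

  *-zeroʳ : ∀ p → (p *ₚ []) ≈ []
  *-zeroʳ []      = ≈-refl
  *-zeroʳ (a ∷ p) = coeffwise λ { zero → refl ; (suc i) → coeff-≡ (*-zeroʳ p) i }

  *-congʳ : ∀ {p p′} q → p ≈ p′ → (p *ₚ q) ≈ (p′ *ₚ q)
  *-congʳ {[]}    {p′}     q e = ≈-sym (*-zeroˡ q (≈-sym e))
  *-congʳ {a ∷ p} {[]}     q e = *-zeroˡ q e
  *-congʳ {a ∷ p} {b ∷ p′} q e =
    +-cong (·-congˡ q (coeff-≡ e zero)) (∷-cong refl (*-congʳ {p} {p′} q (coeffwise λ i → coeff-≡ e (suc i))))

  *-∷ʳ : ∀ p b q → (p *ₚ (b ∷ q)) ≈ ((b ·ₚ p) +ₚ (+ 0 ∷ (p *ₚ q)))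
  *-∷ʳ []      b q = coeffwise λ { zero → refl ; (suc i) → refl }
  *-∷ʳ (a ∷ p) b q =
    ≈-trans (+-cong (≈-refl {(a ℤ.* b) ∷ (a ·ₚ q)}) (∷-cong refl (*-∷ʳ p b q)))
      (∷-cong (swap a b) (≈-trans (+-cong (≈-refl {a ·ₚ q}) (+-comm (b ·ₚ p) (+ 0 ∷ (p *ₚ q))))
        (≈-trans (≈-sym (+-assoc (a ·ₚ q) (+ 0 ∷ (p *ₚ q)) (b ·ₚ p))) (+-comm _ (b ·ₚ p)))))
    where
    swap : ∀ a b → a ℤ.* b ℤ.+ + 0 ≡ b ℤ.* a ℤ.+ + 0
    swap = solve-∀

  *-comm : ∀ p q → (p *ₚ q) ≈ (q *ₚ p)
  *-comm []      q = ≈-sym (*-zeroʳ q)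
  *-comm (a ∷ p) q = ≈-trans (+-cong (≈-refl {a ·ₚ q}) (∷-cong refl (*-comm p q))) (≈-sym (*-∷ʳ q a p))

  *-cong : ∀ {p p′ q q′} → p ≈ p′ → q ≈ q′ → (p *ₚ q) ≈ (p′ *ₚ q′)
  *-cong {p} {p′} {q} {q′} e f =
    ≈-trans (*-congʳ q e) (≈-trans (*-comm p′ q) (≈-trans (*-congʳ p′ f) (*-comm q′ p′)))

  ·-*-assoc : ∀ a q r → ((a ·ₚ q) *ₚ r) ≈ (a ·ₚ (q *ₚ r))
  ·-*-assoc a []      r = ≈-refl
  ·-*-assoc a (b ∷ q) r =
    ≈-trans (+-cong (≈-sym (·-assoc a b r)) (∷-cong refl (·-*-assoc a q r)))
      (≈-trans (+-cong (≈-refl {a ·ₚ (b ·ₚ r)}) (∷-cong (sym (ℤP.*-zeroʳ a)) ≈-refl))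
        (≈-sym (·-distribˡ-+ a (b ·ₚ r) (+ 0 ∷ (q *ₚ r)))))

  *-distribʳ-+ : ∀ p q r → ((p +ₚ q) *ₚ r) ≈ ((p *ₚ r) +ₚ (q *ₚ r))
  *-distribʳ-+ []      q       r = ≈-refl
  *-distribʳ-+ (a ∷ p) []      r = ≈-sym (+-identityʳ _)
  *-distribʳ-+ (a ∷ p) (b ∷ q) r =
    ≈-trans (+-cong (·-distribʳ-+ a b r) (∷-cong (sym (ℤP.+-identityʳ (+ 0))) (*-distribʳ-+ p q r)))
      (+-interchange (a ·ₚ r) (b ·ₚ r) (+ 0 ∷ (p *ₚ r)) (+ 0 ∷ (q *ₚ r)))

  *-distribˡ-+ : ∀ p q r → (p *ₚ (q +ₚ r)) ≈ ((p *ₚ q) +ₚ (p *ₚ r))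
  *-distribˡ-+ p q r =
    ≈-trans (*-comm p (q +ₚ r)) (≈-trans (*-distribʳ-+ q r p) (+-cong (*-comm q p) (*-comm r p)))

  *-assoc : ∀ p q r → ((p *ₚ q) *ₚ r) ≈ (p *ₚ (q *ₚ r))
  *-assoc []      q r = ≈-refl
  *-assoc (a ∷ p) q r =
    ≈-trans (*-distribʳ-+ (a ·ₚ q) (+ 0 ∷ (p *ₚ q)) r)
      (+-cong (·-*-assoc a q r) (≈-trans (+-cong (·-zeroˡ r) ≈-refl) (∷-cong refl (*-assoc p q r))))

  *-identityˡ : ∀ p → (const (+ 1) *ₚ p) ≈ p
  *-identityˡ p =
    ≈-trans (+-cong (·-identityˡ p) (coeffwise λ { zero → refl ; (suc i) → refl })) (+-identityʳ p)

  *-identityʳ : ∀ p → (p *ₚ const (+ 1)) ≈ p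
  *-identityʳ p = ≈-trans (*-comm p _) (*-identityˡ p)

  ·-as-* : ∀ a p → (a ·ₚ p) ≈ (const a *ₚ p)
  ·-as-* a p = ≈-sym (≈-trans (+-cong (≈-refl {a ·ₚ p}) (coeffwise λ { zero → refl ; (suc i) → refl }))
                              (+-identityʳ (a ·ₚ p)))

  isCommutativeRing : IsCommutativeRing _≈_ _+ₚ_ _*ₚ_ -ₚ_ [] (const (+ 1))
  isCommutativeRing = record
    { isRing = record
      { +-isAbelianGroup = record
        { isGroup = record
          { isMonoid = record
            { isSemigroup = record
              { isMagma = record { isEquivalence = ≈-isEquivalence ; ∙-cong = +-cong }
              ; assoc = +-assoc }
            ; identity = +-identityˡ , +-identityʳ }
          ; inverse = +-inverseˡ , +-inverseʳ
          ; ⁻¹-cong = neg-cong }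
        ; comm = +-comm }
      ; *-cong = *-cong
      ; *-assoc = *-assoc
      ; *-identity = *-identityˡ , *-identityʳ
      ; distrib = *-distribˡ-+ , (λ r p q → *-distribʳ-+ p q r) }
    ; *-comm = *-comm }

  commutativeRing : CommutativeRing _ _
  commutativeRing = record { isCommutativeRing = isCommutativeRing }

  const-+ : ∀ a b → const (a ℤ.+ b) ≈ (const a +ₚ const b)
  const-+ a b = ≈-refl

  const-* : ∀ a b → const (a ℤ.* b) ≈ (const a *ₚ const b)
  const-* a b = coeffwise λ { zero → sym (ℤP.+-identityʳ _) ; (suc zero) → refl ; (suc (suc i)) → refl }

  const-neg : ∀ a → const (- a) ≈ (-ₚ const a)
  const-neg a = ≈-refl

  const-0 : const (+ 0) ≈ []
  const-0 = coeffwise λ { zero → refl ; (suc i) → refl }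

  -- Equal closed polynomials trim to the same list, so ≈-by-trim refl decides identities between them.
  trim : Poly → Poly
  trim []      = []
  trim (c ∷ p) = cons c (trim p)
    where
    cons : ℤ → Poly → Poly
    cons c        (d ∷ q) = c ∷ d ∷ q
    cons (+ zero) []      = []
    cons c        []      = c ∷ []

  coeff-trim : ∀ p i → coeff (trim p) i ≡ coeff p i
  coeff-trim []      i = refl
  coeff-trim (c ∷ p) i with trim p | coeff-trim p
  coeff-trim (+ zero    ∷ p) zero    | []    | _  = refl
  coeff-trim (+ zero    ∷ p) (suc i) | []    | ih = ih i
  coeff-trim (+ suc _   ∷ p) zero    | []    | _  = refl
  coeff-trim (+ suc _   ∷ p) (suc i) | []    | ih = ih i
  coeff-trim (ℤ.-[1+ _ ] ∷ p) zero   | []    | _  = refl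
  coeff-trim (ℤ.-[1+ _ ] ∷ p) (suc i) | []   | ih = ih i
  coeff-trim (c ∷ p)         zero    | _ ∷ _ | _  = refl
  coeff-trim (c ∷ p)         (suc i) | _ ∷ _ | ih = ih i

  ≈-by-trim : ∀ {p q} → trim p ≡ trim q → p ≈ q
  ≈-by-trim {p} {q} e = coeffwise λ i →
    trans (sym (coeff-trim p i)) (trans (cong (λ r → coeff r i) e) (coeff-trim q i))

  private
    almostCommutativeRing : AlmostCommutativeRing _ _
    almostCommutativeRing = fromCommutativeRing commutativeRing

    ℤ-rawRing : RawRing _ _
    ℤ-rawRing = CommutativeRing.rawRing ℤP.+-*-commutativeRing

    constMorphism : ℤ-rawRing -Raw-AlmostCommutative⟶ almostCommutativeRing
    constMorphism = record
      { ⟦_⟧ = const ; +-homo = const-+ ; *-homo = const-* ; -‿homo = const-neg ; 0-homo = const-0 ; 1-homo = ≈-refl }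

    const-≟ : ∀ a b → Maybe (const a ≈ const b)
    const-≟ a b with a ℤP.≟ b
    ... | yes refl = just ≈-refl
    ... | no _     = nothing

  open import Algebra.Solver.Ring ℤ-rawRing almostCommutativeRing constMorphism const-≟ public

module Determinant where

  open Polynomial
  open ≈-Reasoning
  open import Data.Nat as ℕ using (ℕ; zero; suc; _<_; s≤s; z≤n)
  import Data.Nat.Properties as ℕP
  open import Data.Integer as ℤ using (+_; -_)
  import Data.Integer.Properties as ℤP
  open import Data.Integer.Tactic.RingSolver using (solve-∀)
  open import Data.Fin as F using (Fin; toℕ; punchIn; inject₁)
  import Data.Fin.Properties as FP
  open import Data.List using ([])
  open import Data.Product using (_×_; _,_)
  open import Data.Sum using (_⊎_; inj₁; inj₂)
  open import Data.Empty using (⊥-elim)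
  open import Relation.Nullary using (Dec; yes; no)
  open import Relation.Binary.PropositionalEquality using (_≡_; _≢_; refl; sym; trans; cong; cong₂; subst)
  open import Function using (_∘_)

  Matrix : ℕ → Set
  Matrix m = Fin m → Fin m → Poly

  sumFin-cong : ∀ m {f g : Fin m → Poly} → (∀ j → f j ≈ g j) → sumFin m f ≈ sumFin m g
  sumFin-cong zero    e = ≈-refl
  sumFin-cong (suc m) e = +-cong (e F.zero) (sumFin-cong m (e ∘ F.suc))

  sumFin-zero : ∀ m {f : Fin m → Poly} → (∀ j → f j ≈ []) → sumFin m f ≈ []
  sumFin-zero zero    e = ≈-refl
  sumFin-zero (suc m) e = +-cong (e F.zero) (sumFin-zero m (e ∘ F.suc))

  sumFin-+ : ∀ m (f g : Fin m → Poly) → sumFin m (λ j → f j +ₚ g j) ≈ sumFin m f +ₚ sumFin m g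
  sumFin-+ zero    f g = ≈-refl
  sumFin-+ (suc m) f g = ≈-trans (+-cong (≈-refl {f F.zero +ₚ g F.zero}) (sumFin-+ m (f ∘ F.suc) (g ∘ F.suc)))
    (+-interchange (f F.zero) (g F.zero) (sumFin m (f ∘ F.suc)) (sumFin m (g ∘ F.suc)))

  sumFin-*ˡ : ∀ m c (f : Fin m → Poly) → c *ₚ sumFin m f ≈ sumFin m (λ j → c *ₚ f j)
  sumFin-*ˡ zero    c f = *-zeroʳ c
  sumFin-*ˡ (suc m) c f =
    ≈-trans (*-distribˡ-+ c (f F.zero) (sumFin m (f ∘ F.suc))) (+-cong (≈-refl {c *ₚ f F.zero}) (sumFin-*ˡ m c (f ∘ F.suc)))

  sumFin-linear : ∀ m α β (f g : Fin m → Poly) →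
    sumFin m (λ j → α *ₚ f j +ₚ β *ₚ g j) ≈ α *ₚ sumFin m f +ₚ β *ₚ sumFin m g
  sumFin-linear m α β f g = ≈-trans (sumFin-+ m (λ j → α *ₚ f j) (λ j → β *ₚ g j))
    (+-cong (≈-sym (sumFin-*ˡ m α f)) (≈-sym (sumFin-*ˡ m β g)))

  sumFin-punchIn : ∀ m (p : Fin (suc m)) (f : Fin (suc m) → Poly) →
    sumFin (suc m) f ≈ f p +ₚ sumFin m (f ∘ punchIn p)
  sumFin-punchIn m       F.zero    f = ≈-refl
  sumFin-punchIn (suc m) (F.suc p) f = begin
    f F.zero +ₚ sumFin (suc m) (f ∘ F.suc)                      ≈⟨ +-cong (≈-refl {f F.zero}) (sumFin-punchIn m p (f ∘ F.suc)) ⟩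
    f F.zero +ₚ (f (F.suc p) +ₚ sumFin m (f ∘ F.suc ∘ punchIn p)) ≈⟨ ≈-sym (+-assoc (f F.zero) (f (F.suc p)) _) ⟩
    (f F.zero +ₚ f (F.suc p)) +ₚ sumFin m (f ∘ F.suc ∘ punchIn p) ≈⟨ +-cong (+-comm (f F.zero) (f (F.suc p))) ≈-refl ⟩
    (f (F.suc p) +ₚ f F.zero) +ₚ sumFin m (f ∘ F.suc ∘ punchIn p) ≈⟨ +-assoc (f (F.suc p)) (f F.zero) _ ⟩
    f (F.suc p) +ₚ (f F.zero +ₚ sumFin m (f ∘ F.suc ∘ punchIn p)) ∎

  det-cong : ∀ m {M N : Matrix m} → (∀ i j → M i j ≈ N i j) → det m M ≈ det m N
  det-cong zero    e = ≈-refl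
  det-cong (suc m) e = sumFin-cong (suc m) λ j →
    ·-congʳ (sign (toℕ j)) (*-cong (e F.zero j) (det-cong m (λ r c → e (F.suc r) (punchIn j c))))

  laplaceTerm : ∀ {m} → Matrix (suc m) → Fin (suc m) → Poly
  laplaceTerm {m} M j = sign (toℕ j) ·ₚ (M F.zero j *ₚ det m (minor M j))

  sign-suc : ∀ k → sign (suc k) ≡ - sign k
  sign-suc zero          = refl
  sign-suc (suc zero)    = refl
  sign-suc (suc (suc k)) = sign-suc k

  sign-+ : ∀ a b → sign (a ℕ.+ b) ≡ sign a ℤ.* sign b
  sign-+ zero    b = sym (ℤP.*-identityˡ (sign b))
  sign-+ (suc a) b =
    trans (sign-suc (a ℕ.+ b)) (trans (cong -_ (sign-+ a b))
      (trans (ℤP.neg-distribˡ-* (sign a) (sign b)) (cong (λ z → z ℤ.* sign b) (sym (sign-suc a)))))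

  sign-double : ∀ k → sign (k ℕ.+ k) ≡ + 1
  sign-double zero    = refl
  sign-double (suc k) = trans (cong (sign ∘ suc) (ℕP.+-suc k k)) (sign-double k)

  -- Column p of a matrix sits at index pivot p l in the minor that deletes column punchIn p l.
  pivot : ∀ {m} → Fin (suc m) → Fin m → Fin m
  pivot F.zero    F.zero    = F.zero
  pivot F.zero    (F.suc l) = F.zero
  pivot (F.suc p) F.zero    = p
  pivot (F.suc p) (F.suc l) = F.suc (pivot p l)

  punchIn-pivot : ∀ {m} (p : Fin (suc m)) l → punchIn (punchIn p l) (pivot p l) ≡ p
  punchIn-pivot F.zero    F.zero    = refl
  punchIn-pivot F.zero    (F.suc l) = refl
  punchIn-pivot (F.suc p) F.zero    = refl
  punchIn-pivot (F.suc p) (F.suc l) = cong F.suc (punchIn-pivot p l)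

  punchIn-punchIn-pivot : ∀ {m} (p : Fin (suc (suc m))) l (s : Fin m) →
    punchIn (punchIn p l) (punchIn (pivot p l) s) ≡ punchIn p (punchIn l s)
  punchIn-punchIn-pivot F.zero    F.zero    s         = refl
  punchIn-punchIn-pivot F.zero    (F.suc l) s         = refl
  punchIn-punchIn-pivot (F.suc p) F.zero    s         = refl
  punchIn-punchIn-pivot (F.suc p) (F.suc l) F.zero    = refl
  punchIn-punchIn-pivot (F.suc p) (F.suc l) (F.suc s) = cong F.suc (punchIn-punchIn-pivot p l s)

  punchIn-≢-pivot : ∀ {m} (p : Fin (suc m)) l s → s ≢ pivot p l → punchIn (punchIn p l) s ≢ p
  punchIn-≢-pivot p l s s≢ e = s≢ (FP.punchIn-injective (punchIn p l) s (pivot p l) (trans e (sym (punchIn-pivot p l))))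

  sign-pivot : ∀ {m} (p : Fin (suc m)) l →
    sign (toℕ (punchIn p l)) ℤ.* sign (toℕ (pivot p l)) ≡ - (sign (toℕ p) ℤ.* sign (toℕ l))
  sign-pivot F.zero    F.zero    = refl
  sign-pivot F.zero    (F.suc l) =
    trans (ℤP.*-identityʳ _) (trans (sign-suc (suc (toℕ l))) (cong -_ (sym (ℤP.*-identityˡ _))))
  sign-pivot (F.suc p) F.zero    =
    trans (ℤP.*-identityˡ _) (trans (sym (ℤP.neg-involutive _))
      (cong -_ (trans (sym (sign-suc (toℕ p))) (sym (ℤP.*-identityʳ _)))))
  sign-pivot (F.suc p) (F.suc l) =
    trans (cong₂ ℤ._*_ (sign-suc (toℕ (punchIn p l))) (sign-suc (toℕ (pivot p l))))
      (trans (neg-*-neg (sign (toℕ (punchIn p l))) (sign (toℕ (pivot p l)))) (trans (sign-pivot p l)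
        (cong -_ (sym (trans (cong₂ ℤ._*_ (sign-suc (toℕ p)) (sign-suc (toℕ l)))
                             (neg-*-neg (sign (toℕ p)) (sign (toℕ l))))))))
    where
    neg-*-neg : ∀ a b → (- a) ℤ.* (- b) ≡ a ℤ.* b
    neg-*-neg = solve-∀

  det-linear-column : ∀ m (c : Fin m) (α β : Poly) (M N P : Matrix m) →
    (∀ r s → s ≢ c → M r s ≈ P r s) → (∀ r s → s ≢ c → N r s ≈ P r s) →
    (∀ r → P r c ≈ α *ₚ M r c +ₚ β *ₚ N r c) →
    det m P ≈ α *ₚ det m M +ₚ β *ₚ det m N
  det-linear-column (suc m) c α β M N P M≈P N≈P Pc = begin
    det (suc m) P
      ≈⟨ sumFin-punchIn m c (laplaceTerm P) ⟩
    laplaceTerm P c +ₚ sumFin m (laplaceTerm P ∘ punchIn c)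
      ≈⟨ +-cong termAt-c (sumFin-cong m termOff-c) ⟩
    (α *ₚ tM c +ₚ β *ₚ tN c) +ₚ sumFin m (λ l → α *ₚ tM (punchIn c l) +ₚ β *ₚ tN (punchIn c l))
      ≈⟨ +-cong (≈-refl {α *ₚ tM c +ₚ β *ₚ tN c}) (sumFin-linear m α β (tM ∘ punchIn c) (tN ∘ punchIn c)) ⟩
    (α *ₚ tM c +ₚ β *ₚ tN c) +ₚ (α *ₚ sumFin m (tM ∘ punchIn c) +ₚ β *ₚ sumFin m (tN ∘ punchIn c))
      ≈⟨ solve 6 (λ α β A B C D → (α :* A :+ β :* B) :+ (α :* C :+ β :* D) := α :* (A :+ C) :+ β :* (B :+ D))
               ≈-refl α β (tM c) (tN c) (sumFin m (tM ∘ punchIn c)) (sumFin m (tN ∘ punchIn c)) ⟩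
    α *ₚ (tM c +ₚ sumFin m (tM ∘ punchIn c)) +ₚ β *ₚ (tN c +ₚ sumFin m (tN ∘ punchIn c))
      ≈⟨ ≈-sym (+-cong (*-cong (≈-refl {α}) (sumFin-punchIn m c tM)) (*-cong (≈-refl {β}) (sumFin-punchIn m c tN))) ⟩
    α *ₚ det (suc m) M +ₚ β *ₚ det (suc m) N ∎
    where
    tM = laplaceTerm M
    tN = laplaceTerm N

    termAt-c : laplaceTerm P c ≈ α *ₚ tM c +ₚ β *ₚ tN c
    termAt-c = begin
      σ ·ₚ (P F.zero c *ₚ det m (minor P c))
        ≈⟨ ·-congʳ σ (*-cong (Pc F.zero) (≈-refl {det m (minor P c)})) ⟩
      σ ·ₚ ((α *ₚ M F.zero c +ₚ β *ₚ N F.zero c) *ₚ det m (minor P c))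
        ≈⟨ ·-as-* σ _ ⟩
      const σ *ₚ ((α *ₚ M F.zero c +ₚ β *ₚ N F.zero c) *ₚ det m (minor P c))
        ≈⟨ solve 6 (λ S α β y z D → S :* ((α :* y :+ β :* z) :* D) := α :* (S :* (y :* D)) :+ β :* (S :* (z :* D)))
                 ≈-refl (const σ) α β (M F.zero c) (N F.zero c) (det m (minor P c)) ⟩
      α *ₚ (const σ *ₚ (M F.zero c *ₚ det m (minor P c))) +ₚ β *ₚ (const σ *ₚ (N F.zero c *ₚ det m (minor P c)))
        ≈⟨ +-cong (*-cong (≈-refl {α}) (≈-trans (≈-sym (·-as-* σ _)) (minorOf M M≈P)))
                  (*-cong (≈-refl {β}) (≈-trans (≈-sym (·-as-* σ _)) (minorOf N N≈P))) ⟩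
      α *ₚ tM c +ₚ β *ₚ tN c ∎
      where
      σ = sign (toℕ c)
      minorOf : ∀ Q → (∀ r s → s ≢ c → Q r s ≈ P r s) →
        σ ·ₚ (Q F.zero c *ₚ det m (minor P c)) ≈ laplaceTerm Q c
      minorOf Q Q≈P = ·-congʳ σ (*-cong (≈-refl {Q F.zero c})
        (det-cong m (λ r s → ≈-sym (Q≈P (F.suc r) (punchIn c s) (FP.punchInᵢ≢i c s)))))

    termOff-c : ∀ l → laplaceTerm P (punchIn c l) ≈ α *ₚ tM (punchIn c l) +ₚ β *ₚ tN (punchIn c l)
    termOff-c l = begin
      σ ·ₚ (P F.zero k *ₚ det m (minor P k))
        ≈⟨ ·-congʳ σ (*-cong (≈-refl {P F.zero k}) minorLinear) ⟩
      σ ·ₚ (P F.zero k *ₚ (α *ₚ det m (minor M k) +ₚ β *ₚ det m (minor N k)))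
        ≈⟨ ·-as-* σ _ ⟩
      const σ *ₚ (P F.zero k *ₚ (α *ₚ det m (minor M k) +ₚ β *ₚ det m (minor N k)))
        ≈⟨ solve 6 (λ S α β x A B → S :* (x :* (α :* A :+ β :* B)) := α :* (S :* (x :* A)) :+ β :* (S :* (x :* B)))
                 ≈-refl (const σ) α β (P F.zero k) (det m (minor M k)) (det m (minor N k)) ⟩
      α *ₚ (const σ *ₚ (P F.zero k *ₚ det m (minor M k))) +ₚ β *ₚ (const σ *ₚ (P F.zero k *ₚ det m (minor N k)))
        ≈⟨ +-cong (*-cong (≈-refl {α}) (≈-trans (≈-sym (·-as-* σ _)) (entryOf M M≈P)))
                  (*-cong (≈-refl {β}) (≈-trans (≈-sym (·-as-* σ _)) (entryOf N N≈P))) ⟩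
      α *ₚ tM k +ₚ β *ₚ tN k ∎
      where
      k = punchIn c l
      σ = sign (toℕ k)
      k≢c = FP.punchInᵢ≢i c l
      minorLinear : det m (minor P k) ≈ α *ₚ det m (minor M k) +ₚ β *ₚ det m (minor N k)
      minorLinear = det-linear-column m (pivot c l) α β (minor M k) (minor N k) (minor P k)
        (λ r s s≢ → M≈P (F.suc r) (punchIn k s) (punchIn-≢-pivot c l s s≢))
        (λ r s s≢ → N≈P (F.suc r) (punchIn k s) (punchIn-≢-pivot c l s s≢))
        (λ r → subst (λ z → P (F.suc r) z ≈ α *ₚ M (F.suc r) z +ₚ β *ₚ N (F.suc r) z)
                     (sym (punchIn-pivot c l)) (Pc (F.suc r)))
      entryOf : ∀ Q → (∀ r s → s ≢ c → Q r s ≈ P r s) →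
        σ ·ₚ (P F.zero k *ₚ det m (minor Q k)) ≈ laplaceTerm Q k
      entryOf Q Q≈P = ·-congʳ σ (*-cong (≈-sym (Q≈P F.zero k k≢c)) (≈-refl {det m (minor Q k)}))

  det-zero-column : ∀ m (c : Fin m) (M : Matrix m) → (∀ r → M r c ≈ []) → det m M ≈ []
  det-zero-column m c M Mc≈0 = det-linear-column m c [] [] M M M (λ _ _ _ → ≈-refl) (λ _ _ _ → ≈-refl) Mc≈0

  sign-pivot-+ : ∀ {m} (p : Fin (suc m)) l (q : ℕ) →
    sign (toℕ (punchIn p l)) ℤ.* sign (toℕ (pivot p l) ℕ.+ q) ≡ sign (toℕ p ℕ.+ suc q) ℤ.* sign (toℕ l)
  sign-pivot-+ p l q =
    trans (cong (sign (toℕ (punchIn p l)) ℤ.*_) (sign-+ (toℕ (pivot p l)) q))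
      (trans (sym (ℤP.*-assoc (sign (toℕ (punchIn p l))) _ _))
      (trans (cong (ℤ._* sign q) (sign-pivot p l))
      (trans (rearrange (sign (toℕ p)) (sign (toℕ l)) (sign q))
      (cong (ℤ._* sign (toℕ l)) (sym (trans (sign-+ (toℕ p) (suc q)) (cong (sign (toℕ p) ℤ.*_) (sign-suc q))))))))
    where
    rearrange : ∀ a b c → (- (a ℤ.* b)) ℤ.* c ≡ (a ℤ.* (- c)) ℤ.* b
    rearrange = solve-∀

  det-column-single-entry : ∀ m (p q : Fin (suc m)) (M : Matrix (suc m)) → (∀ r → r ≢ q → M r p ≈ []) →
    det (suc m) M ≈ sign (toℕ p ℕ.+ toℕ q) ·ₚ (M q p *ₚ det m (λ r s → M (punchIn q r) (punchIn p s)))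
  det-column-single-entry m p F.zero M single = begin
    det (suc m) M                                                 ≈⟨ sumFin-punchIn m p (laplaceTerm M) ⟩
    laplaceTerm M p +ₚ sumFin m (laplaceTerm M ∘ punchIn p)        ≈⟨ +-cong (≈-refl {laplaceTerm M p}) (sumFin-zero m vanish) ⟩
    laplaceTerm M p +ₚ []                                         ≈⟨ +-identityʳ _ ⟩
    laplaceTerm M p                                               ≈⟨ ·-congˡ _ (cong sign (sym (ℕP.+-identityʳ (toℕ p)))) ⟩
    sign (toℕ p ℕ.+ 0) ·ₚ (M F.zero p *ₚ det m (minor M p))        ∎
    where
    vanish : ∀ l → laplaceTerm M (punchIn p l) ≈ []
    vanish l = ·-congʳ (sign (toℕ (punchIn p l))) (≈-trans (*-cong (≈-refl {M F.zero (punchIn p l)})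
      (det-zero-column m (pivot p l) (minor M (punchIn p l))
        (λ r → subst (λ z → M (F.suc r) z ≈ []) (sym (punchIn-pivot p l)) (single (F.suc r) λ ()))))
      (*-zeroʳ (M F.zero (punchIn p l))))
  det-column-single-entry (suc m) p (F.suc q) M single = begin
    det (suc (suc m)) M
      ≈⟨ sumFin-punchIn (suc m) p (laplaceTerm M) ⟩
    laplaceTerm M p +ₚ sumFin (suc m) (laplaceTerm M ∘ punchIn p)
      ≈⟨ +-cong (·-congʳ (sign (toℕ p)) (*-zeroˡ (det (suc m) (minor M p)) (single F.zero λ ())))
                (sumFin-cong (suc m) term) ⟩
    [] +ₚ sumFin (suc m) (λ l → (const σ *ₚ M (F.suc q) p) *ₚ laplaceTerm M′ l)
      ≈⟨ ≈-sym (sumFin-*ˡ (suc m) (const σ *ₚ M (F.suc q) p) (laplaceTerm M′)) ⟩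
    (const σ *ₚ M (F.suc q) p) *ₚ det (suc m) M′
      ≈⟨ ≈-trans (*-assoc (const σ) (M (F.suc q) p) (det (suc m) M′)) (≈-sym (·-as-* σ _)) ⟩
    σ ·ₚ (M (F.suc q) p *ₚ det (suc m) M′) ∎
    where
    σ = sign (toℕ p ℕ.+ toℕ (F.suc q))
    M′ : Matrix (suc m)
    M′ r s = M (punchIn (F.suc q) r) (punchIn p s)
    term : ∀ l → laplaceTerm M (punchIn p l) ≈ (const σ *ₚ M (F.suc q) p) *ₚ laplaceTerm M′ l
    term l = begin
      τ ·ₚ (M F.zero k *ₚ det (suc m) (minor M k))
        ≈⟨ ·-congʳ τ (*-cong (≈-refl {M F.zero k}) expandMinor) ⟩
      τ ·ₚ (M F.zero k *ₚ (ρ ·ₚ (M (F.suc q) p *ₚ det m M″)))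
        ≈⟨ ≈-trans (·-as-* τ _) (*-cong (≈-refl {const τ}) (*-cong (≈-refl {M F.zero k}) (·-as-* ρ _))) ⟩
      const τ *ₚ (M F.zero k *ₚ (const ρ *ₚ (M (F.suc q) p *ₚ det m M″)))
        ≈⟨ solve 5 (λ T R x y D → T :* (x :* (R :* (y :* D))) := (T :* R) :* (x :* y :* D))
                 ≈-refl (const τ) (const ρ) (M F.zero k) (M (F.suc q) p) (det m M″) ⟩
      (const τ *ₚ const ρ) *ₚ ((M F.zero k *ₚ M (F.suc q) p) *ₚ det m M″)
        ≈⟨ *-cong (≈-trans (≈-sym (const-* τ ρ)) (≈-trans (≈-reflexive (cong const (sign-pivot-+ p l (toℕ q))))
                                                           (const-* σ (sign (toℕ l)))))
                  ≈-refl ⟩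
      (const σ *ₚ const (sign (toℕ l))) *ₚ ((M F.zero k *ₚ M (F.suc q) p) *ₚ det m M″)
        ≈⟨ solve 5 (λ S L x y D → (S :* L) :* (x :* y :* D) := (S :* y) :* (L :* (x :* D)))
                 ≈-refl (const σ) (const (sign (toℕ l))) (M F.zero k) (M (F.suc q) p) (det m M″) ⟩
      (const σ *ₚ M (F.suc q) p) *ₚ (const (sign (toℕ l)) *ₚ (M F.zero k *ₚ det m M″))
        ≈⟨ *-cong (≈-refl {const σ *ₚ M (F.suc q) p}) (≈-trans (≈-sym (·-as-* (sign (toℕ l)) _))
             (·-congʳ (sign (toℕ l)) (*-cong (≈-refl {M F.zero k})
               (det-cong m (λ r s → ≈-reflexive (cong (M (F.suc (punchIn q r))) (punchIn-punchIn-pivot p l s))))))) ⟩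
      (const σ *ₚ M (F.suc q) p) *ₚ laplaceTerm M′ l ∎
      where
      k = punchIn p l
      τ = sign (toℕ k)
      ρ = sign (toℕ (pivot p l) ℕ.+ toℕ q)
      M″ : Matrix m
      M″ r s = M (F.suc (punchIn q r)) (punchIn k (punchIn (pivot p l) s))
      expandMinor : det (suc m) (minor M k) ≈ ρ ·ₚ (M (F.suc q) p *ₚ det m M″)
      expandMinor = ≈-trans
        (det-column-single-entry m (pivot p l) q (minor M k)
          (λ r r≢q → subst (λ z → M (F.suc r) z ≈ []) (sym (punchIn-pivot p l)) (single (F.suc r) (r≢q ∘ FP.suc-injective))))
        (·-congʳ ρ (*-cong (≈-reflexive (cong (M (F.suc q)) (punchIn-pivot p l))) (≈-refl {det m M″})))

  -- Columns inject₁ p and suc p of a matrix, after deleting its column adjacentOther p l,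
  -- sit at adjacentPivot p l and its successor.
  adjacentOther : ∀ {m} → Fin (suc m) → Fin m → Fin (suc (suc m))
  adjacentOther p l = punchIn (inject₁ p) (punchIn p l)

  adjacentPivot : ∀ {m} → Fin (suc m) → Fin m → Fin m
  adjacentPivot F.zero    F.zero    = F.zero
  adjacentPivot F.zero    (F.suc l) = F.zero
  adjacentPivot (F.suc p) F.zero    = p
  adjacentPivot (F.suc p) (F.suc l) = F.suc (adjacentPivot p l)

  punchIn-adjacentPivot : ∀ {m} (p : Fin (suc m)) l →
    punchIn (adjacentOther p l) (inject₁ (adjacentPivot p l)) ≡ inject₁ p
  punchIn-adjacentPivot F.zero    F.zero    = refl
  punchIn-adjacentPivot F.zero    (F.suc l) = refl
  punchIn-adjacentPivot (F.suc p) F.zero    = refl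
  punchIn-adjacentPivot (F.suc p) (F.suc l) = cong F.suc (punchIn-adjacentPivot p l)

  punchIn-suc-adjacentPivot : ∀ {m} (p : Fin (suc m)) l →
    punchIn (adjacentOther p l) (F.suc (adjacentPivot p l)) ≡ F.suc p
  punchIn-suc-adjacentPivot F.zero    F.zero    = refl
  punchIn-suc-adjacentPivot F.zero    (F.suc l) = refl
  punchIn-suc-adjacentPivot (F.suc p) F.zero    = refl
  punchIn-suc-adjacentPivot (F.suc p) (F.suc l) = cong F.suc (punchIn-suc-adjacentPivot p l)

  punchIn-inject₁-self : ∀ {m} (p : Fin m) → punchIn (inject₁ p) p ≡ F.suc p
  punchIn-inject₁-self F.zero    = refl
  punchIn-inject₁-self (F.suc p) = cong F.suc (punchIn-inject₁-self p)

  punchIn-inject₁-or-suc : ∀ {m} (p s : Fin m) →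
    punchIn (inject₁ p) s ≡ punchIn (F.suc p) s ⊎ (punchIn (inject₁ p) s ≡ F.suc p × punchIn (F.suc p) s ≡ inject₁ p)
  punchIn-inject₁-or-suc F.zero    F.zero    = inj₂ (refl , refl)
  punchIn-inject₁-or-suc F.zero    (F.suc s) = inj₁ refl
  punchIn-inject₁-or-suc (F.suc p) F.zero    = inj₁ refl
  punchIn-inject₁-or-suc (F.suc p) (F.suc s) with punchIn-inject₁-or-suc p s
  ... | inj₁ e       = inj₁ (cong F.suc e)
  ... | inj₂ (e , f) = inj₂ (cong F.suc e , cong F.suc f)

  det-adjacent-equal-columns : ∀ m (p : Fin m) (M : Matrix (suc m)) →
    (∀ r → M r (inject₁ p) ≈ M r (F.suc p)) → det (suc m) M ≈ []
  det-adjacent-equal-columns (suc m) p M equal = begin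
    det (suc (suc m)) M
      ≈⟨ sumFin-punchIn (suc m) (inject₁ p) (laplaceTerm M) ⟩
    t (inject₁ p) +ₚ sumFin (suc m) (t ∘ punchIn (inject₁ p))
      ≈⟨ +-cong (≈-refl {t (inject₁ p)}) (sumFin-punchIn m p (t ∘ punchIn (inject₁ p))) ⟩
    t (inject₁ p) +ₚ (t (punchIn (inject₁ p) p) +ₚ sumFin m (t ∘ adjacentOther p))
      ≈⟨ ≈-sym (+-assoc (t (inject₁ p)) _ _) ⟩
    (t (inject₁ p) +ₚ t (punchIn (inject₁ p) p)) +ₚ sumFin m (t ∘ adjacentOther p)
      ≈⟨ +-cong pairCancels (sumFin-zero m othersVanish) ⟩
    [] ∎
    where
    t = laplaceTerm M
    sameMinor : ∀ r s → minor M (inject₁ p) r s ≈ minor M (F.suc p) r s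
    sameMinor r s with punchIn-inject₁-or-suc p s
    ... | inj₁ e       = ≈-reflexive (cong (M (F.suc r)) e)
    ... | inj₂ (e , f) = ≈-trans (≈-reflexive (cong (M (F.suc r)) e))
                          (≈-trans (≈-sym (equal (F.suc r))) (≈-reflexive (cong (M (F.suc r)) (sym f))))
    σ = sign (toℕ p)
    x = M F.zero (inject₁ p)
    D = det (suc m) (minor M (inject₁ p))
    pairCancels : t (inject₁ p) +ₚ t (punchIn (inject₁ p) p) ≈ []
    pairCancels = begin
      t (inject₁ p) +ₚ t (punchIn (inject₁ p) p)
        ≈⟨ +-cong (·-congˡ (x *ₚ D) (cong sign (FP.toℕ-inject₁ p)))
                  (≈-trans (≈-reflexive (cong t (punchIn-inject₁-self p)))
                    (≈-trans (·-congˡ _ (sign-suc (toℕ p)))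
                      (·-congʳ (- σ) (*-cong (≈-sym (equal F.zero)) (≈-sym (det-cong (suc m) sameMinor)))))) ⟩
      σ ·ₚ (x *ₚ D) +ₚ (- σ) ·ₚ (x *ₚ D)    ≈⟨ ≈-sym (·-distribʳ-+ σ (- σ) (x *ₚ D)) ⟩
      (σ ℤ.+ - σ) ·ₚ (x *ₚ D)               ≈⟨ ·-congˡ (x *ₚ D) (ℤP.+-inverseʳ σ) ⟩
      + 0 ·ₚ (x *ₚ D)                       ≈⟨ ·-zeroˡ _ ⟩
      [] ∎
    othersVanish : ∀ l → t (adjacentOther p l) ≈ []
    othersVanish l = ·-congʳ (sign (toℕ (adjacentOther p l)))
      (≈-trans (*-cong (≈-refl {M F.zero (adjacentOther p l)})
        (det-adjacent-equal-columns m (adjacentPivot p l) (minor M (adjacentOther p l))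
          (λ r → ≈-trans (≈-reflexive (cong (M (F.suc r)) (punchIn-adjacentPivot p l)))
                   (≈-trans (equal (F.suc r)) (≈-reflexive (cong (M (F.suc r)) (sym (punchIn-suc-adjacentPivot p l))))))))
        (*-zeroʳ (M F.zero (adjacentOther p l))))

  det-additive-column : ∀ m (c : Fin m) (M N P : Matrix m) →
    (∀ r s → s ≢ c → M r s ≈ P r s) → (∀ r s → s ≢ c → N r s ≈ P r s) →
    (∀ r → P r c ≈ M r c +ₚ N r c) →
    det m P ≈ det m M +ₚ det m N
  det-additive-column m c M N P M≈P N≈P Pc =
    ≈-trans (det-linear-column m c 1ₚ 1ₚ M N P M≈P N≈P
              (λ r → ≈-trans (Pc r) (≈-sym (+-cong (*-identityˡ (M r c)) (*-identityˡ (N r c))))))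
            (+-cong (*-identityˡ (det m M)) (*-identityˡ (det m N)))
    where 1ₚ = const (+ 1)

  swapAdjacent : ∀ {m} → Fin m → Fin (suc m) → Fin (suc m)
  swapAdjacent F.zero    F.zero            = F.suc F.zero
  swapAdjacent F.zero    (F.suc F.zero)    = F.zero
  swapAdjacent F.zero    (F.suc (F.suc s)) = F.suc (F.suc s)
  swapAdjacent (F.suc p) F.zero            = F.zero
  swapAdjacent (F.suc p) (F.suc s)         = F.suc (swapAdjacent p s)

  swapAdjacent-inject₁ : ∀ {m} (p : Fin m) → swapAdjacent p (inject₁ p) ≡ F.suc p
  swapAdjacent-inject₁ F.zero    = refl
  swapAdjacent-inject₁ (F.suc p) = cong F.suc (swapAdjacent-inject₁ p)

  swapAdjacent-suc : ∀ {m} (p : Fin m) → swapAdjacent p (F.suc p) ≡ inject₁ p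
  swapAdjacent-suc F.zero    = refl
  swapAdjacent-suc (F.suc p) = cong F.suc (swapAdjacent-suc p)

  swapAdjacent-other : ∀ {m} (p : Fin m) s → s ≢ inject₁ p → s ≢ F.suc p → swapAdjacent p s ≡ s
  swapAdjacent-other F.zero    F.zero            s≢p _     = ⊥-elim (s≢p refl)
  swapAdjacent-other F.zero    (F.suc F.zero)    _   s≢p+1 = ⊥-elim (s≢p+1 refl)
  swapAdjacent-other F.zero    (F.suc (F.suc s)) _   _     = refl
  swapAdjacent-other (F.suc p) F.zero            _   _     = refl
  swapAdjacent-other (F.suc p) (F.suc s)         s≢p s≢p+1 =
    cong F.suc (swapAdjacent-other p s (s≢p ∘ cong F.suc) (s≢p+1 ∘ cong F.suc))

  swapAdjacent-involutive : ∀ {m} (p : Fin m) s → swapAdjacent p (swapAdjacent p s) ≡ s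
  swapAdjacent-involutive F.zero    F.zero            = refl
  swapAdjacent-involutive F.zero    (F.suc F.zero)    = refl
  swapAdjacent-involutive F.zero    (F.suc (F.suc s)) = refl
  swapAdjacent-involutive (F.suc p) F.zero            = refl
  swapAdjacent-involutive (F.suc p) (F.suc s)         = cong F.suc (swapAdjacent-involutive p s)

  inject₁≢suc : ∀ {m} (p : Fin m) → inject₁ p ≢ F.suc p
  inject₁≢suc p e = ℕP.<⇒≢ (ℕP.n<1+n (toℕ p)) (trans (sym (FP.toℕ-inject₁ p)) (cong toℕ e))

  -- A x y is M with its columns inject₁ p and suc p replaced by x and y. Each det (A x x) vanishes, so
  -- expanding 0 = det (A (u + v) (u + v)) by additivity in both columns leaves det (A u v) + det (A v u).
  det-swap-adjacent-columns : ∀ m (p : Fin m) (M : Matrix (suc m)) →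
    det (suc m) (λ r s → M r (swapAdjacent p s)) ≈ -ₚ det (suc m) M
  det-swap-adjacent-columns m p M = begin
    det (suc m) (M ∘₂ swapAdjacent p)                                         ≈⟨ ≈-sym (+-identityˡ _) ⟩
    [] +ₚ det (suc m) (M ∘₂ swapAdjacent p)                                   ≈⟨ +-cong (≈-sym (+-inverseˡ (det (suc m) M))) ≈-refl ⟩
    ((-ₚ det (suc m) M) +ₚ det (suc m) M) +ₚ det (suc m) (M ∘₂ swapAdjacent p) ≈⟨ +-assoc (-ₚ det (suc m) M) _ _ ⟩
    (-ₚ det (suc m) M) +ₚ (det (suc m) M +ₚ det (suc m) (M ∘₂ swapAdjacent p)) ≈⟨ +-cong (≈-refl { -ₚ det (suc m) M}) sumVanishes ⟩
    (-ₚ det (suc m) M) +ₚ []                                                  ≈⟨ +-identityʳ _ ⟩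
    -ₚ det (suc m) M ∎
    where
    _∘₂_ : Matrix (suc m) → (Fin (suc m) → Fin (suc m)) → Matrix (suc m)
    (N ∘₂ f) r s = N r (f s)
    a = inject₁ p
    b = F.suc p
    A : (x y : Fin (suc m) → Poly) → Matrix (suc m)
    A x y r s with s F.≟ a | s F.≟ b
    ... | yes _ | _     = x r
    ... | no _  | yes _ = y r
    ... | no _  | no _  = M r s
    A-a : ∀ x y r → A x y r a ≈ x r
    A-a x y r with a F.≟ a
    ... | yes _  = ≈-refl
    ... | no a≢a = ⊥-elim (a≢a refl)
    A-b : ∀ x y r → A x y r b ≈ y r
    A-b x y r with b F.≟ a | b F.≟ b
    ... | yes b≡a | _      = ⊥-elim (inject₁≢suc p (sym b≡a))
    ... | no _    | yes _  = ≈-refl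
    ... | no _    | no b≢b = ⊥-elim (b≢b refl)
    A-other : ∀ x y r s → s ≢ a → s ≢ b → A x y r s ≈ M r s
    A-other x y r s s≢a s≢b with s F.≟ a | s F.≟ b
    ... | yes s≡a | _      = ⊥-elim (s≢a s≡a)
    ... | no _    | yes s≡b = ⊥-elim (s≢b s≡b)
    ... | no _    | no _    = ≈-refl
    A-off-a : ∀ x x′ y r s → s ≢ a → A x y r s ≈ A x′ y r s
    A-off-a x x′ y r s s≢a = case (s F.≟ b)
      where
      case : Dec (s ≡ b) → A x y r s ≈ A x′ y r s
      case (yes refl) = ≈-trans (A-b x y r) (≈-sym (A-b x′ y r))
      case (no s≢b)   = ≈-trans (A-other x y r s s≢a s≢b) (≈-sym (A-other x′ y r s s≢a s≢b))
    A-off-b : ∀ x y y′ r s → s ≢ b → A x y r s ≈ A x y′ r s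
    A-off-b x y y′ r s s≢b = case (s F.≟ a)
      where
      case : Dec (s ≡ a) → A x y r s ≈ A x y′ r s
      case (yes refl) = ≈-trans (A-a x y r) (≈-sym (A-a x y′ r))
      case (no s≢a)   = ≈-trans (A-other x y r s s≢a s≢b) (≈-sym (A-other x y′ r s s≢a s≢b))
    u v u+v : Fin (suc m) → Poly
    u r = M r a
    v r = M r b
    u+v r = u r +ₚ v r
    A-diagonal : ∀ x → det (suc m) (A x x) ≈ []
    A-diagonal x = det-adjacent-equal-columns m p (A x x) (λ r → ≈-trans (A-a x x r) (≈-sym (A-b x x r)))
    additive-a : ∀ y → det (suc m) (A u+v y) ≈ det (suc m) (A u y) +ₚ det (suc m) (A v y)
    additive-a y = det-additive-column (suc m) a (A u y) (A v y) (A u+v y)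
      (λ r s → A-off-a u u+v y r s) (λ r s → A-off-a v u+v y r s)
      (λ r → ≈-trans (A-a u+v y r) (≈-sym (+-cong (A-a u y r) (A-a v y r))))
    additive-b : ∀ x → det (suc m) (A x u+v) ≈ det (suc m) (A x u) +ₚ det (suc m) (A x v)
    additive-b x = det-additive-column (suc m) b (A x u) (A x v) (A x u+v)
      (λ r s → A-off-b x u u+v r s) (λ r s → A-off-b x v u+v r s)
      (λ r → ≈-trans (A-b x u+v r) (≈-sym (+-cong (A-b x u r) (A-b x v r))))
    A-uv : ∀ r s → A u v r s ≈ M r s
    A-uv r s = case (s F.≟ a) (s F.≟ b)
      where
      case : Dec (s ≡ a) → Dec (s ≡ b) → A u v r s ≈ M r s
      case (yes refl) _          = A-a u v r
      case (no _)     (yes refl) = A-b u v r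
      case (no s≢a)   (no s≢b)   = A-other u v r s s≢a s≢b
    A-vu : ∀ r s → A v u r s ≈ M r (swapAdjacent p s)
    A-vu r s = case (s F.≟ a) (s F.≟ b)
      where
      case : Dec (s ≡ a) → Dec (s ≡ b) → A v u r s ≈ M r (swapAdjacent p s)
      case (yes refl) _          = ≈-trans (A-a v u r) (≈-reflexive (cong (M r) (sym (swapAdjacent-inject₁ p))))
      case (no _)     (yes refl) = ≈-trans (A-b v u r) (≈-reflexive (cong (M r) (sym (swapAdjacent-suc p))))
      case (no s≢a)   (no s≢b)   =
        ≈-trans (A-other v u r s s≢a s≢b) (≈-reflexive (cong (M r) (sym (swapAdjacent-other p s s≢a s≢b))))
    sumVanishes : det (suc m) M +ₚ det (suc m) (M ∘₂ swapAdjacent p) ≈ []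
    sumVanishes = begin
      det (suc m) M +ₚ det (suc m) (M ∘₂ swapAdjacent p)
        ≈⟨ ≈-sym (+-cong (det-cong (suc m) A-uv) (det-cong (suc m) A-vu)) ⟩
      det (suc m) (A u v) +ₚ det (suc m) (A v u)
        ≈⟨ ≈-sym (+-cong (+-cong (A-diagonal u) (≈-refl {det (suc m) (A u v)}))
                         (≈-trans (+-cong (≈-refl {det (suc m) (A v u)}) (A-diagonal v)) (+-identityʳ _))) ⟩
      (det (suc m) (A u u) +ₚ det (suc m) (A u v)) +ₚ (det (suc m) (A v u) +ₚ det (suc m) (A v v))
        ≈⟨ ≈-sym (+-cong (additive-b u) (additive-b v)) ⟩
      det (suc m) (A u u+v) +ₚ det (suc m) (A v u+v)
        ≈⟨ ≈-sym (additive-a u+v) ⟩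
      det (suc m) (A u+v u+v)
        ≈⟨ A-diagonal u+v ⟩
      [] ∎

  det-equal-columns : ∀ m (i j : Fin (suc m)) (M : Matrix (suc m)) →
    toℕ i < toℕ j → (∀ r → M r i ≈ M r j) → det (suc m) M ≈ []
  det-equal-columns m i j M i<j = atGap (toℕ j ℕ.∸ suc (toℕ i)) i j M
    (sym (trans (ℕP.+-suc (toℕ i) _) (ℕP.m+[n∸m]≡n i<j)))
    where
    atGap : ∀ d (i j : Fin (suc m)) (M : Matrix (suc m)) →
      toℕ j ≡ toℕ i ℕ.+ suc d → (∀ r → M r i ≈ M r j) → det (suc m) M ≈ []
    atGap d i F.zero M gap _ = ⊥-elim (ℕP.0≢1+n (trans gap (ℕP.+-suc (toℕ i) d)))
    atGap zero i (F.suc j) M gap equal =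
      det-adjacent-equal-columns m j M (λ r → ≈-trans (≈-reflexive (cong (M r) (sym i≡j))) (equal r))
      where
      i≡j : i ≡ inject₁ j
      i≡j = FP.toℕ-injective (trans (ℕP.suc-injective (trans (sym (ℕP.+-comm (toℕ i) 1)) (sym gap)))
                                    (sym (FP.toℕ-inject₁ j)))
    atGap (suc d) i (F.suc j) M gap equal = begin
      det (suc m) M
        ≈⟨ det-cong (suc m) (λ r s → ≈-reflexive (cong (M r) (sym (swapAdjacent-involutive j s)))) ⟩
      det (suc m) (λ r s → M′ r (swapAdjacent j s))  ≈⟨ det-swap-adjacent-columns m j M′ ⟩
      -ₚ det (suc m) M′                              ≈⟨ neg-cong (atGap d i (inject₁ j) M′ gap′ equal′) ⟩
      []                                             ∎
      where
      M′ : Matrix (suc m)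
      M′ r s = M r (swapAdjacent j s)
      beyond : ∀ {k} e → toℕ k ≡ toℕ i ℕ.+ suc e → i ≢ k
      beyond e k≡ i≡k = ℕP.<⇒≢ (ℕP.m<m+n (toℕ i) (s≤s z≤n)) (trans (cong toℕ i≡k) k≡)
      gap′ : toℕ (inject₁ j) ≡ toℕ i ℕ.+ suc d
      gap′ = trans (FP.toℕ-inject₁ j) (ℕP.suc-injective (trans gap (ℕP.+-suc (toℕ i) (suc d))))
      equal′ : ∀ r → M′ r i ≈ M′ r (inject₁ j)
      equal′ r = ≈-trans (≈-reflexive (cong (M r) (swapAdjacent-other j i (beyond d gap′) (beyond (suc d) gap))))
                   (≈-trans (equal r) (≈-reflexive (cong (M r) (sym (swapAdjacent-inject₁ j)))))

module PrincipalMinors {T : Set} (w : T → T → Poly) (a : Poly) where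

  open Polynomial
  open ≈-Reasoning
  open Determinant
  open import Data.Nat as ℕ using (ℕ; zero; suc; _<_; _≤_; s≤s)
  import Data.Nat.Properties as ℕP
  open import Data.Fin as F using (Fin; toℕ; punchIn)
  import Data.Fin.Properties as FP
  open import Data.Bool using (if_then_else_; _∧_)
  open import Data.List using ([])
  open import Data.Empty using (⊥-elim)
  open import Function using (_∘_)
  open import Function.Bundles using (_⇔_; mk⇔)
  open import Relation.Nullary using (does; yes; no)
  open import Relation.Nullary.Decidable using (dec-true; dec-false; does-⇔)
  open import Relation.Binary.PropositionalEquality using (_≡_; _≢_; refl; sym; trans; cong; cong₂; subst; subst₂)

  deleteAt : ℕ → (ℕ → T) → ℕ → T
  deleteAt r τ n = if does (n ℕ.<? r) then τ n else τ (suc n)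

  deleteAt-< : ∀ r τ {n} → n < r → deleteAt r τ n ≡ τ n
  deleteAt-< r τ {n} n<r = cong (if_then τ n else τ (suc n)) (dec-true (n ℕ.<? r) n<r)

  deleteAt-≥ : ∀ r τ {n} → r ≤ n → deleteAt r τ n ≡ τ (suc n)
  deleteAt-≥ r τ {n} r≤n = cong (if_then τ n else τ (suc n)) (dec-false (n ℕ.<? r) (ℕP.≤⇒≯ r≤n))

  toℕ-punchIn-< : ∀ {m} (p : Fin (suc m)) i → toℕ i < toℕ p → toℕ (punchIn p i) ≡ toℕ i
  toℕ-punchIn-< F.zero    i         ()
  toℕ-punchIn-< (F.suc p) F.zero    _         = refl
  toℕ-punchIn-< (F.suc p) (F.suc i) (s≤s i<p) = cong suc (toℕ-punchIn-< p i i<p)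

  toℕ-punchIn-≥ : ∀ {m} (p : Fin (suc m)) i → toℕ p ≤ toℕ i → toℕ (punchIn p i) ≡ suc (toℕ i)
  toℕ-punchIn-≥ F.zero    i         _         = refl
  toℕ-punchIn-≥ (F.suc p) (F.suc i) (s≤s p≤i) = cong suc (toℕ-punchIn-≥ p i p≤i)

  deleteAt-punchIn : ∀ {m} τ (p : Fin (suc m)) i → deleteAt (toℕ p) τ (toℕ i) ≡ τ (toℕ (punchIn p i))
  deleteAt-punchIn τ p i with toℕ i ℕ.<? toℕ p
  ... | yes i<p = trans (deleteAt-< (toℕ p) τ i<p) (cong τ (sym (toℕ-punchIn-< p i i<p)))
  ... | no  i≮p = trans (deleteAt-≥ (toℕ p) τ (ℕP.≮⇒≥ i≮p)) (cong τ (sym (toℕ-punchIn-≥ p i (ℕP.≮⇒≥ i≮p))))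

  ≤-punchIn⇔ : ∀ {m} (p : Fin (suc m)) j → toℕ p ≤ toℕ (punchIn p j) ⇔ toℕ p ≤ toℕ j
  ≤-punchIn⇔ p j = mk⇔ to from
    where
    to : toℕ p ≤ toℕ (punchIn p j) → toℕ p ≤ toℕ j
    to p≤ with toℕ j ℕ.<? toℕ p
    ... | yes j<p = ⊥-elim (ℕP.<⇒≱ (subst (_< toℕ p) (sym (toℕ-punchIn-< p j j<p)) j<p) p≤)
    ... | no  j≮p = ℕP.≮⇒≥ j≮p
    from : toℕ p ≤ toℕ j → toℕ p ≤ toℕ (punchIn p j)
    from p≤j = subst (toℕ p ≤_) (sym (toℕ-punchIn-≥ p j p≤j)) (ℕP.m≤n⇒m≤1+n p≤j)

  typeMatrix : ∀ m → (ℕ → T) → Matrix m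
  typeMatrix m τ i j = w (τ (toℕ i)) (τ (toℕ j))

  diagonalFrom : ∀ {m} → ℕ → Matrix m
  diagonalFrom r i j = if does (r ℕ.≤? toℕ j) ∧ does (i F.≟ j) then a else []

  diagonalFrom-cong : ∀ {m m′} {r r′} {i j : Fin m} {i′ j′ : Fin m′} →
    (r ≤ toℕ j ⇔ r′ ≤ toℕ j′) → (i ≡ j ⇔ i′ ≡ j′) → diagonalFrom r i j ≡ diagonalFrom r′ i′ j′
  diagonalFrom-cong {r = r} {r′} {i} {j} {i′} {j′} r≤j⇔ i≡j⇔ = cong₂ (λ b c → if b ∧ c then a else [])
    (does-⇔ r≤j⇔ (r ℕ.≤? toℕ j) (r′ ℕ.≤? toℕ j′)) (does-⇔ i≡j⇔ (i F.≟ j) (i′ F.≟ j′))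

  diagonalFrom-< : ∀ {m} r (i j : Fin m) → toℕ j < r → diagonalFrom r i j ≡ []
  diagonalFrom-< r i j j<r = cong (λ b → if b ∧ does (i F.≟ j) then a else []) (dec-false (r ℕ.≤? toℕ j) (ℕP.<⇒≱ j<r))

  diagonalFrom-≥ : ∀ {m} r (i j : Fin m) → r ≤ toℕ j → diagonalFrom r i j ≡ (if does (i F.≟ j) then a else [])
  diagonalFrom-≥ r i j r≤j = cong (λ b → if b ∧ does (i F.≟ j) then a else []) (dec-true (r ℕ.≤? toℕ j) r≤j)

  shiftedFrom : ∀ m → ℕ → (ℕ → T) → Matrix m
  shiftedFrom m r τ i j = diagonalFrom r i j +ₚ typeMatrix m τ i j

  -- Expanding det (shiftedFrom (r + k) r τ) by linearity in the columns r, …, r + k - 1 in turn.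
  Φ : ℕ → ℕ → (ℕ → T) → Poly
  Φ r zero    τ = det r (typeMatrix r τ)
  Φ r (suc k) τ = a *ₚ Φ r k (deleteAt r τ) +ₚ Φ (suc r) k τ

  -- Column p of P splits as a times the p-th unit vector (the column of Pₐ) plus the column of N.
  det-shiftedFrom-step : ∀ k m (p : Fin (suc m)) τ →
    det m (shiftedFrom m (toℕ p) (deleteAt (toℕ p) τ)) ≈ Φ (toℕ p) k (deleteAt (toℕ p) τ) →
    det (suc m) (shiftedFrom (suc m) (suc (toℕ p)) τ) ≈ Φ (suc (toℕ p)) k τ →
    det (suc m) (shiftedFrom (suc m) (toℕ p) τ) ≈ Φ (toℕ p) (suc k) τ
  det-shiftedFrom-step k m p τ expandRest expandNext = begin
    det (suc m) P
      ≈⟨ det-additive-column (suc m) p Pₐ N P Pₐ≈P N≈P P-at-p ⟩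
    det (suc m) Pₐ +ₚ det (suc m) N
      ≈⟨ +-cong (det-column-single-entry m p p Pₐ Pₐ-single) expandNext ⟩
    sign (r ℕ.+ r) ·ₚ (Pₐ p p *ₚ det m minorₐ) +ₚ Φ (suc r) k τ
      ≈⟨ +-cong (≈-trans (·-congˡ _ (sign-double r)) (·-identityˡ _)) (≈-refl {Φ (suc r) k τ}) ⟩
    Pₐ p p *ₚ det m minorₐ +ₚ Φ (suc r) k τ
      ≈⟨ +-cong (*-cong Pₐ-pp (≈-trans (det-cong m minorₐ≈) expandRest)) (≈-refl {Φ (suc r) k τ}) ⟩
    a *ₚ Φ r k (deleteAt r τ) +ₚ Φ (suc r) k τ ∎
    where
    r = toℕ p
    P = shiftedFrom (suc m) r τ
    N = shiftedFrom (suc m) (suc r) τ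
    Pₐ : Matrix (suc m)
    Pₐ i j = if does (j F.≟ p) then (if does (i F.≟ p) then a else []) else P i j
    minorₐ : Matrix m
    minorₐ i j = Pₐ (punchIn p i) (punchIn p j)
    Pₐ-at-p : ∀ i → Pₐ i p ≡ (if does (i F.≟ p) then a else [])
    Pₐ-at-p i = cong (if_then (if does (i F.≟ p) then a else []) else P i p) (dec-true (p F.≟ p) refl)
    Pₐ≈P : ∀ i s → s ≢ p → Pₐ i s ≈ P i s
    Pₐ≈P i s s≢p = ≈-reflexive (cong (if_then (if does (i F.≟ p) then a else []) else P i s) (dec-false (s F.≟ p) s≢p))
    N≈P : ∀ i s → s ≢ p → N i s ≈ P i s
    N≈P i s s≢p = ≈-reflexive (cong (_+ₚ typeMatrix (suc m) τ i s)
      (diagonalFrom-cong {i = i} {j = s} {i′ = i} {j′ = s}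
        (mk⇔ ℕP.<⇒≤ (λ r≤s → ℕP.≤∧≢⇒< r≤s (s≢p ∘ FP.toℕ-injective ∘ sym))) (mk⇔ (λ e → e) (λ e → e))))
    P-at-p : ∀ i → P i p ≈ Pₐ i p +ₚ N i p
    P-at-p i = ≈-reflexive (cong₂ _+ₚ_
      (trans (diagonalFrom-≥ r i p ℕP.≤-refl) (sym (Pₐ-at-p i)))
      (cong (_+ₚ typeMatrix (suc m) τ i p) (sym (diagonalFrom-< (suc r) i p (ℕP.n<1+n r)))))
    Pₐ-single : ∀ i → i ≢ p → Pₐ i p ≈ []
    Pₐ-single i i≢p = ≈-reflexive (trans (Pₐ-at-p i) (cong (if_then a else []) (dec-false (i F.≟ p) i≢p)))
    Pₐ-pp : Pₐ p p ≈ a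
    Pₐ-pp = ≈-reflexive (trans (Pₐ-at-p p) (cong (if_then a else []) (dec-true (p F.≟ p) refl)))
    minorₐ≈ : ∀ i j → minorₐ i j ≈ shiftedFrom m r (deleteAt r τ) i j
    minorₐ≈ i j = ≈-trans (Pₐ≈P (punchIn p i) (punchIn p j) (FP.punchInᵢ≢i p j)) (≈-reflexive (cong₂ _+ₚ_
      (diagonalFrom-cong (≤-punchIn⇔ p j) (mk⇔ (FP.punchIn-injective p i j) (cong (punchIn p))))
      (sym (cong₂ w (deleteAt-punchIn τ p i) (deleteAt-punchIn τ p j)))))

  det-shiftedFrom : ∀ k r m τ → m ≡ r ℕ.+ k → det m (shiftedFrom m r τ) ≈ Φ r k τ
  det-shiftedFrom zero r m τ m≡r+0 with trans m≡r+0 (ℕP.+-identityʳ r)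
  ... | refl = det-cong r (λ i j → ≈-reflexive (cong (_+ₚ typeMatrix r τ i j) (diagonalFrom-< r i j (FP.toℕ<n j))))
  det-shiftedFrom (suc k) r zero    τ 0≡ = ⊥-elim (ℕP.0≢1+n (trans 0≡ (ℕP.+-suc r k)))
  det-shiftedFrom (suc k) r (suc m) τ m≡ =
    subst (λ r′ → det (suc m) (shiftedFrom (suc m) r′ τ) ≈ Φ r′ (suc k) τ) toℕ-p
      (det-shiftedFrom-step k m p τ
        (det-shiftedFrom k (toℕ p) m (deleteAt (toℕ p) τ) (trans m≡r+k (cong (ℕ._+ k) (sym toℕ-p))))
        (det-shiftedFrom k (suc (toℕ p)) (suc m) τ (trans (cong suc m≡r+k) (cong (λ z → suc z ℕ.+ k) (sym toℕ-p)))))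
    where
    m≡r+k : m ≡ r ℕ.+ k
    m≡r+k = ℕP.suc-injective (trans m≡ (ℕP.+-suc r k))
    r<1+m : r < suc m
    r<1+m = s≤s (subst (r ≤_) (sym m≡r+k) (ℕP.m≤m+n r k))
    p : Fin (suc m)
    p = F.fromℕ< r<1+m
    toℕ-p : toℕ p ≡ r
    toℕ-p = FP.toℕ-fromℕ< r<1+m

  Φ-ext : ∀ k r τ τ′ → (∀ n → n < r ℕ.+ k → τ n ≡ τ′ n) → Φ r k τ ≈ Φ r k τ′
  Φ-ext zero    r τ τ′ agree = det-cong r λ i j → ≈-reflexive (cong₂ w (agree′ i) (agree′ j))
    where
    agree′ : ∀ (i : Fin r) → τ (toℕ i) ≡ τ′ (toℕ i)
    agree′ i = agree (toℕ i) (subst (toℕ i <_) (sym (ℕP.+-identityʳ r)) (FP.toℕ<n i))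
  Φ-ext (suc k) r τ τ′ agree =
    +-cong (*-cong (≈-refl {a}) (Φ-ext k r (deleteAt r τ) (deleteAt r τ′) agreeDeleted))
           (Φ-ext k (suc r) τ τ′ (λ n n< → agree n (subst (n <_) (sym (ℕP.+-suc r k)) n<)))
    where
    agreeDeleted : ∀ n → n < r ℕ.+ k → deleteAt r τ n ≡ deleteAt r τ′ n
    agreeDeleted n n< with n ℕ.<? r
    ... | yes n<r = trans (deleteAt-< r τ n<r) (trans (agree n (ℕP.<-≤-trans n< (ℕP.+-monoʳ-≤ r (ℕP.n≤1+n k))))
                                                       (sym (deleteAt-< r τ′ n<r)))
    ... | no  n≮r = trans (deleteAt-≥ r τ (ℕP.≮⇒≥ n≮r))
                     (trans (agree (suc n) (subst (suc n <_) (sym (ℕP.+-suc r k)) (s≤s n<)))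
                            (sym (deleteAt-≥ r τ′ (ℕP.≮⇒≥ n≮r))))

  Φ-duplicate : ∀ k r τ {i j} → i < j → j < r → τ i ≡ τ j → Φ r k τ ≈ []
  Φ-duplicate zero (suc r) τ {i} {j} i<j j<r τi≡τj =
    det-equal-columns r (F.fromℕ< i<r) (F.fromℕ< j<r) (typeMatrix (suc r) τ)
      (subst₂ _<_ (sym (FP.toℕ-fromℕ< i<r)) (sym (FP.toℕ-fromℕ< j<r)) i<j)
      (λ x → ≈-reflexive (cong (w (τ (toℕ x)))
        (trans (cong τ (FP.toℕ-fromℕ< i<r)) (trans τi≡τj (cong τ (sym (FP.toℕ-fromℕ< j<r)))))))
    where
    i<r = ℕP.<-trans i<j j<r
  Φ-duplicate (suc k) r τ {i} {j} i<j j<r τi≡τj =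
    ≈-trans (+-cong (*-cong (≈-refl {a}) (Φ-duplicate k r (deleteAt r τ) i<j j<r
                      (trans (deleteAt-< r τ (ℕP.<-trans i<j j<r)) (trans τi≡τj (sym (deleteAt-< r τ j<r))))))
                    (Φ-duplicate k (suc r) τ i<j (ℕP.m<n⇒m<1+n j<r) τi≡τj))
            (+-cong (*-zeroʳ a) (≈-refl {[]}))

module ThreeKinds where

  open Polynomial
  open ≈-Reasoning
  open Determinant
  open import Data.Nat as ℕ using (ℕ; zero; suc; _<_; _≤_; s≤s; z≤n)
  import Data.Nat.Properties as ℕP
  open import Data.Integer as ℤ using (ℤ; +_; -[1+_])
  open import Data.Fin as F using (toℕ)
  open import Data.Bool using (Bool; true; false; if_then_else_)
  open import Data.List using (List; []; _∷_; length; lookup; _∷ʳ_)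
  import Data.List.Properties as LP
  open import Data.List.Membership.Propositional using (_∈_)
  open import Data.List.Relation.Unary.Any using (here; there)
  open import Data.Product using (∃; _×_; _,_)
  open import Data.Sum using (_⊎_; inj₁; inj₂)
  open import Data.Unit using (⊤; tt)
  open import Data.Empty using (⊥-elim)
  open import Function using (_∘_)
  open import Relation.Nullary using (does; yes; no)
  open import Relation.Nullary.Decidable using (dec-true; dec-false)
  open import Relation.Binary.Definitions using (DecidableEquality)
  open import Relation.Binary.PropositionalEquality using (_≡_; _≢_; refl; sym; trans; cong; cong₂; subst)

  data Kind : Set where
    ident gen other : Kind

  _≟ᵏ_ : DecidableEquality Kind
  ident ≟ᵏ ident = yes refl
  ident ≟ᵏ gen   = no λ ()
  ident ≟ᵏ other = no λ ()
  gen   ≟ᵏ ident = no λ ()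
  gen   ≟ᵏ gen   = yes refl
  gen   ≟ᵏ other = no λ ()
  other ≟ᵏ ident = no λ ()
  other ≟ᵏ gen   = no λ ()
  other ≟ᵏ other = yes refl

  -- Minus the distance between distinct vertices of the given kinds. On the diagonal the entry
  -- x of xI − D is written a − 1, so the value −1 serves there too.
  negDist : Kind → Kind → ℤ
  negDist ident gen   = -[1+ 1 ]
  negDist gen   ident = -[1+ 1 ]
  negDist _     _     = -[1+ 0 ]

  a : Poly
  a = X +ₚ const (+ 1)

  open PrincipalMinors (λ s t → const (negDist s t)) a public

  -- The principal minor of the negDist-matrix on one vertex of each flagged kind (identity, generator, other).
  δ : Bool → Bool → Bool → ℤ
  δ false false false = + 1
  δ true  false false = -[1+ 0 ]
  δ false true  false = -[1+ 0 ]
  δ false false true  = -[1+ 0 ]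
  δ true  true  false = -[1+ 2 ]
  δ true  false true  = + 0
  δ false true  true  = + 0
  δ true  true  true  = + 1

  -- g · a ^ (g − 1), written without truncated subtraction.
  derivPow : ℕ → Poly
  derivPow zero    = []
  derivPow (suc g) = a ^ₚ g +ₚ a *ₚ derivPow g

  derivPow-suc : ∀ g → derivPow (suc g) ≈ const (+ suc g) *ₚ a ^ₚ g
  derivPow-suc zero    = ≈-by-trim refl
  derivPow-suc (suc g) = begin
    a ^ₚ suc g +ₚ a *ₚ derivPow (suc g)            ≈⟨ +-cong (≈-refl {a ^ₚ suc g}) (*-cong (≈-refl {a}) (derivPow-suc g)) ⟩
    a *ₚ a ^ₚ g +ₚ a *ₚ (const (+ suc g) *ₚ a ^ₚ g) ≈⟨ solve 3 (λ A P G → A :* P :+ A :* (G :* P) := (con (+ 1) :+ G) :* (A :* P))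
                                                              ≈-refl a (a ^ₚ g) (const (+ suc g)) ⟩
    const (+ suc (suc g)) *ₚ a ^ₚ suc g ∎

  -- Expanding over the g remaining vertices of one kind: the kind is already present in the prefix or
  -- not (first flag), and present in the chosen principal minor or not (second flag).
  block : Bool → Bool → ℕ → Poly
  block false false g = a ^ₚ g
  block false true  g = derivPow g
  block true  true  g = a ^ₚ g
  block true  false g = []

  block-suc : ∀ u c g → block u c (suc g) ≈ a *ₚ block u c g +ₚ (if u then [] else block true c g)
  block-suc false false g = ≈-sym (+-identityʳ _)
  block-suc false true  g = +-comm (a ^ₚ g) (a *ₚ derivPow g)
  block-suc true  true  g = ≈-sym (+-identityʳ _)
  block-suc true  false g = ≈-sym (≈-trans (+-identityʳ _) (*-zeroʳ a))

  bilinear : (Bool → Bool → ℤ) → (Bool → Poly) → (Bool → Poly) → Poly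
  bilinear d u v =
    const (d false false) *ₚ (u false *ₚ v false) +ₚ const (d false true) *ₚ (u false *ₚ v true) +ₚ
    const (d true false)  *ₚ (u true *ₚ v false)  +ₚ const (d true true)  *ₚ (u true *ₚ v true)

  bilinear-cong : ∀ d {u u′ v v′} → (∀ c → u c ≈ u′ c) → (∀ c → v c ≈ v′ c) → bilinear d u v ≈ bilinear d u′ v′
  bilinear-cong d u≈ v≈ = +-cong (+-cong (+-cong (term false false) (term false true)) (term true false)) (term true true)
    where
    term : ∀ c c′ → _ ≈ _
    term c c′ = *-cong (≈-refl {const (d c c′)}) (*-cong (u≈ c) (v≈ c′))

  bilinear-stepˡ : ∀ d u u′ v → bilinear d (λ c → a *ₚ u c +ₚ u′ c) v ≈ a *ₚ bilinear d u v +ₚ bilinear d u′ v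
  bilinear-stepˡ d u u′ v =
    solve 11 (λ A D₀₀ D₀₁ D₁₀ D₁₁ U₀ U₁ U′₀ U′₁ V₀ V₁ →
        D₀₀ :* ((A :* U₀ :+ U′₀) :* V₀) :+ D₀₁ :* ((A :* U₀ :+ U′₀) :* V₁) :+
        D₁₀ :* ((A :* U₁ :+ U′₁) :* V₀) :+ D₁₁ :* ((A :* U₁ :+ U′₁) :* V₁)
      := A :* (D₀₀ :* (U₀ :* V₀) :+ D₀₁ :* (U₀ :* V₁) :+ D₁₀ :* (U₁ :* V₀) :+ D₁₁ :* (U₁ :* V₁)) :+
         (D₀₀ :* (U′₀ :* V₀) :+ D₀₁ :* (U′₀ :* V₁) :+ D₁₀ :* (U′₁ :* V₀) :+ D₁₁ :* (U′₁ :* V₁)))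
      ≈-refl a (const (d false false)) (const (d false true)) (const (d true false)) (const (d true true))
      (u false) (u true) (u′ false) (u′ true) (v false) (v true)

  bilinear-stepʳ : ∀ d u v v′ → bilinear d u (λ c → a *ₚ v c +ₚ v′ c) ≈ a *ₚ bilinear d u v +ₚ bilinear d u v′
  bilinear-stepʳ d u v v′ =
    solve 11 (λ A D₀₀ D₀₁ D₁₀ D₁₁ U₀ U₁ V₀ V₁ V′₀ V′₁ →
        D₀₀ :* (U₀ :* (A :* V₀ :+ V′₀)) :+ D₀₁ :* (U₀ :* (A :* V₁ :+ V′₁)) :+
        D₁₀ :* (U₁ :* (A :* V₀ :+ V′₀)) :+ D₁₁ :* (U₁ :* (A :* V₁ :+ V′₁))
      := A :* (D₀₀ :* (U₀ :* V₀) :+ D₀₁ :* (U₀ :* V₁) :+ D₁₀ :* (U₁ :* V₀) :+ D₁₁ :* (U₁ :* V₁)) :+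
         (D₀₀ :* (U₀ :* V′₀) :+ D₀₁ :* (U₀ :* V′₁) :+ D₁₀ :* (U₁ :* V′₀) :+ D₁₁ :* (U₁ :* V′₁)))
      ≈-refl a (const (d false false)) (const (d false true)) (const (d true false)) (const (d true true))
      (u false) (u true) (v false) (v true) (v′ false) (v′ true)

  bilinear-zeroʳ : ∀ d u → bilinear d u (λ _ → []) ≈ []
  bilinear-zeroʳ d u = +-cong (+-cong (+-cong (term false false) (term false true)) (term true false)) (term true true)
    where
    term : ∀ c c′ → const (d c c′) *ₚ (u c *ₚ []) ≈ []
    term c c′ = ≈-trans (*-cong (≈-refl {const (d c c′)}) (*-zeroʳ (u c))) (*-zeroʳ (const (d c c′)))

  closedForm : Bool → Bool → Bool → ℕ → ℕ → Poly
  closedForm z γ ο g h = bilinear (δ z) (λ c → block γ c g) (λ c → block ο c h)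

  closedForm-zero : ∀ z γ ο → closedForm z γ ο 0 0 ≈ const (δ z γ ο)
  closedForm-zero false false false = ≈-by-trim refl
  closedForm-zero false false true  = ≈-by-trim refl
  closedForm-zero false true  false = ≈-by-trim refl
  closedForm-zero false true  true  = ≈-by-trim refl
  closedForm-zero true  false false = ≈-by-trim refl
  closedForm-zero true  false true  = ≈-by-trim refl
  closedForm-zero true  true  false = ≈-by-trim refl
  closedForm-zero true  true  true  = ≈-by-trim refl

  closedForm-suc-gen : ∀ z γ ο g h →
    closedForm z γ ο (suc g) h ≈ a *ₚ closedForm z γ ο g h +ₚ (if γ then [] else closedForm z true ο g h)
  closedForm-suc-gen z γ ο g h =
    ≈-trans (bilinear-cong (δ z) {v = λ c → block ο c h} (λ c → block-suc γ c g) (λ c → ≈-refl))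
      (≈-trans (bilinear-stepˡ (δ z) (λ c → block γ c g) (λ c → if γ then [] else block true c g) (λ c → block ο c h))
        (+-cong (≈-refl {a *ₚ closedForm z γ ο g h}) (newlyChosen γ)))
    where
    newlyChosen : ∀ γ → bilinear (δ z) (λ c → if γ then [] else block true c g) (λ c → block ο c h)
                          ≈ (if γ then [] else closedForm z true ο g h)
    newlyChosen false = ≈-refl
    newlyChosen true  = ≈-by-trim refl

  closedForm-suc-other : ∀ z γ ο g h →
    closedForm z γ ο g (suc h) ≈ a *ₚ closedForm z γ ο g h +ₚ (if ο then [] else closedForm z γ true g h)
  closedForm-suc-other z γ ο g h =
    ≈-trans (bilinear-cong (δ z) {u = λ c → block γ c g} (λ c → ≈-refl) (λ c → block-suc ο c h))
      (≈-trans (bilinear-stepʳ (δ z) (λ c → block γ c g) (λ c → block ο c h) (λ c → if ο then [] else block true c h))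
        (+-cong (≈-refl {a *ₚ closedForm z γ ο g h}) (newlyChosen ο)))
    where
    newlyChosen : ∀ ο → bilinear (δ z) (λ c → block γ c g) (λ c → if ο then [] else block true c h)
                          ≈ (if ο then [] else closedForm z γ true g h)
    newlyChosen false = ≈-refl
    newlyChosen true  = bilinear-zeroʳ (δ z) (λ c → block γ c g)

  -- The kinds of the vertices already taken, after the identity (if present), in order of index.
  data Taken : List Kind → Bool → Bool → Set where
    ⟨⟩    : Taken [] false false
    ⟨g⟩   : Taken (gen ∷ []) true false
    ⟨o⟩   : Taken (other ∷ []) false true
    ⟨g,o⟩ : Taken (gen ∷ other ∷ []) true true
    ⟨o,g⟩ : Taken (other ∷ gen ∷ []) true true

  withIdent : Bool → List Kind → List Kind
  withIdent z ℓ = if z then ident ∷ ℓ else ℓ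

  negDistDet : List Kind → Poly
  negDistDet ℓ = det (length ℓ) (λ i j → const (negDist (lookup ℓ i) (lookup ℓ j)))

  negDistDet-taken : ∀ z {ℓ γ ο} → Taken ℓ γ ο → negDistDet (withIdent z ℓ) ≈ const (δ z γ ο)
  negDistDet-taken false ⟨⟩    = ≈-by-trim refl
  negDistDet-taken false ⟨g⟩   = ≈-by-trim refl
  negDistDet-taken false ⟨o⟩   = ≈-by-trim refl
  negDistDet-taken false ⟨g,o⟩ = ≈-by-trim refl
  negDistDet-taken false ⟨o,g⟩ = ≈-by-trim refl
  negDistDet-taken true  ⟨⟩    = ≈-by-trim refl
  negDistDet-taken true  ⟨g⟩   = ≈-by-trim refl
  negDistDet-taken true  ⟨o⟩   = ≈-by-trim refl
  negDistDet-taken true  ⟨g,o⟩ = ≈-by-trim refl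
  negDistDet-taken true  ⟨o,g⟩ = ≈-by-trim refl

  Taken-∷ʳ-gen : ∀ {ℓ ο} → Taken ℓ false ο → Taken (ℓ ∷ʳ gen) true ο
  Taken-∷ʳ-gen ⟨⟩  = ⟨g⟩
  Taken-∷ʳ-gen ⟨o⟩ = ⟨o,g⟩

  Taken-∷ʳ-other : ∀ {ℓ γ} → Taken ℓ γ false → Taken (ℓ ∷ʳ other) γ true
  Taken-∷ʳ-other ⟨⟩  = ⟨o⟩
  Taken-∷ʳ-other ⟨g⟩ = ⟨g,o⟩

  Taken-gen∈ : ∀ {ℓ ο} → Taken ℓ true ο → gen ∈ ℓ
  Taken-gen∈ ⟨g⟩   = here refl
  Taken-gen∈ ⟨g,o⟩ = here refl
  Taken-gen∈ ⟨o,g⟩ = there (here refl)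

  Taken-other∈ : ∀ {ℓ γ} → Taken ℓ γ true → other ∈ ℓ
  Taken-other∈ ⟨o⟩   = here refl
  Taken-other∈ ⟨g,o⟩ = there (here refl)
  Taken-other∈ ⟨o,g⟩ = here refl

  withIdent-∈ : ∀ z {t ℓ} → t ∈ ℓ → t ∈ withIdent z ℓ
  withIdent-∈ false t∈ℓ = t∈ℓ
  withIdent-∈ true  t∈ℓ = there t∈ℓ

  withIdent-∷ʳ : ∀ z ℓ t → withIdent z (ℓ ∷ʳ t) ≡ withIdent z ℓ ∷ʳ t
  withIdent-∷ʳ false ℓ t = refl
  withIdent-∷ʳ true  ℓ t = refl

  Lists : List Kind → ℕ → (ℕ → Kind) → Set
  Lists []      r τ = ⊤
  Lists (t ∷ ℓ) r τ = τ r ≡ t × Lists ℓ (suc r) τ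

  Lists-lookup : ∀ ℓ {r τ} → Lists ℓ r τ → ∀ i → τ (r ℕ.+ toℕ i) ≡ lookup ℓ i
  Lists-lookup (t ∷ ℓ) {r} {τ} (τr≡t , _)  F.zero    = trans (cong τ (ℕP.+-identityʳ r)) τr≡t
  Lists-lookup (t ∷ ℓ) {r} {τ} (_ , lists) (F.suc i) = trans (cong τ (ℕP.+-suc r (toℕ i))) (Lists-lookup ℓ lists i)

  Lists-∷ʳ : ∀ ℓ {t r τ} → Lists ℓ r τ → τ (r ℕ.+ length ℓ) ≡ t → Lists (ℓ ∷ʳ t) r τ
  Lists-∷ʳ []      {r = r} {τ} _              τ≡t = trans (cong τ (sym (ℕP.+-identityʳ r))) τ≡t , tt
  Lists-∷ʳ (s ∷ ℓ) {r = r} {τ} (τr≡s , lists) τ≡t =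
    τr≡s , Lists-∷ʳ ℓ lists (trans (cong τ (sym (ℕP.+-suc r (length ℓ)))) τ≡t)

  Lists-deleteAt : ∀ ℓ {r s τ} → Lists ℓ r τ → r ℕ.+ length ℓ ≤ s → Lists ℓ r (deleteAt s τ)
  Lists-deleteAt []      _                    _     = tt
  Lists-deleteAt (t ∷ ℓ) {r} {s} {τ} (τr≡t , lists) r+ℓ≤s =
    trans (deleteAt-< s τ (ℕP.<-≤-trans (ℕP.m<m+n r (s≤s z≤n)) r+ℓ≤s)) τr≡t ,
    Lists-deleteAt ℓ lists (subst (_≤ s) (ℕP.+-suc r (length ℓ)) r+ℓ≤s)

  Lists-∈ : ∀ ℓ {t r τ} → t ∈ ℓ → Lists ℓ r τ → ∃ λ j → j < r ℕ.+ length ℓ × τ j ≡ t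
  Lists-∈ (s ∷ ℓ) {r = r} (here refl) (τr≡s , _) = r , ℕP.m<m+n r (s≤s z≤n) , τr≡s
  Lists-∈ (s ∷ ℓ) {r = r} (there t∈ℓ) (_ , lists) with Lists-∈ ℓ t∈ℓ lists
  ... | j , j< , τj≡t = j , subst (j <_) (sym (ℕP.+-suc r (length ℓ))) j< , τj≡t

  Φ-listed : ∀ ℓ τ → Lists ℓ 0 τ → Φ (length ℓ) 0 τ ≈ negDistDet ℓ
  Φ-listed ℓ τ lists = det-cong (length ℓ) λ i j → ≈-reflexive (cong₂ (λ s t → const (negDist s t))
    (Lists-lookup ℓ lists i) (Lists-lookup ℓ lists j))

  count : Kind → ℕ → ℕ → (ℕ → Kind) → ℕ
  count t r zero    τ = 0
  count t r (suc k) τ = (if does (τ r ≟ᵏ t) then 1 else 0) ℕ.+ count t (suc r) k τ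

  count-≡ : ∀ t r k τ → τ r ≡ t → count t r (suc k) τ ≡ suc (count t (suc r) k τ)
  count-≡ t r k τ τr≡t = cong (λ b → (if b then 1 else 0) ℕ.+ count t (suc r) k τ) (dec-true (τ r ≟ᵏ t) τr≡t)

  count-≢ : ∀ t r k τ → τ r ≢ t → count t r (suc k) τ ≡ count t (suc r) k τ
  count-≢ t r k τ τr≢t = cong (λ b → (if b then 1 else 0) ℕ.+ count t (suc r) k τ) (dec-false (τ r ≟ᵏ t) τr≢t)

  count-ext : ∀ t k r r′ τ τ′ → (∀ i → i < k → τ (r ℕ.+ i) ≡ τ′ (r′ ℕ.+ i)) → count t r k τ ≡ count t r′ k τ′
  count-ext t zero    r r′ τ τ′ agree = refl
  count-ext t (suc k) r r′ τ τ′ agree = cong₂ (λ u v → (if does (u ≟ᵏ t) then 1 else 0) ℕ.+ v)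
    (trans (cong τ (sym (ℕP.+-identityʳ r))) (trans (agree 0 (s≤s z≤n)) (cong τ′ (ℕP.+-identityʳ r′))))
    (count-ext t k (suc r) (suc r′) τ τ′ λ i i<k →
      trans (cong τ (sym (ℕP.+-suc r i))) (trans (agree (suc i) (s≤s i<k)) (cong τ′ (ℕP.+-suc r′ i))))

  count-deleteAt : ∀ t k r τ → count t r k (deleteAt r τ) ≡ count t (suc r) k τ
  count-deleteAt t k r τ = count-ext t k r (suc r) (deleteAt r τ) τ λ i _ → deleteAt-≥ r τ (ℕP.m≤m+n r i)

  NoIdent : ℕ → ℕ → (ℕ → Kind) → Set
  NoIdent r k τ = ∀ i → i < k → τ (r ℕ.+ i) ≢ ident

  NoIdent-head : ∀ {r k τ} → NoIdent r (suc k) τ → τ r ≢ ident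
  NoIdent-head {r} {τ = τ} noIdent = noIdent 0 (s≤s z≤n) ∘ trans (cong τ (ℕP.+-identityʳ r))

  NoIdent-tail : ∀ {r k τ} → NoIdent r (suc k) τ → NoIdent (suc r) k τ
  NoIdent-tail {r} {τ = τ} noIdent i i<k = noIdent (suc i) (s≤s i<k) ∘ trans (cong τ (ℕP.+-suc r i))

  NoIdent-deleteAt : ∀ {r k τ} → NoIdent r (suc k) τ → NoIdent r k (deleteAt r τ)
  NoIdent-deleteAt {r} {τ = τ} noIdent i i<k =
    NoIdent-tail {r} {τ = τ} noIdent i i<k ∘ trans (sym (deleteAt-≥ r τ (ℕP.m≤m+n r i)))

  gen≢other : gen ≢ other
  gen≢other ()

  gen-or-other : ∀ t → t ≢ ident → t ≡ gen ⊎ t ≡ other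
  gen-or-other ident t≢ident = ⊥-elim (t≢ident refl)
  gen-or-other gen   _       = inj₁ refl
  gen-or-other other _       = inj₂ refl

  count-last : ∀ t r k τ → τ (r ℕ.+ k) ≢ t → count t r (suc k) τ ≡ count t r k τ
  count-last t r zero    τ τ≢t = count-≢ t r 0 τ (τ≢t ∘ trans (cong τ (ℕP.+-identityʳ r)))
  count-last t r (suc k) τ τ≢t =
    cong ((if does (τ r ≟ᵏ t) then 1 else 0) ℕ.+_) (count-last t (suc r) k τ (τ≢t ∘ trans (cong τ (ℕP.+-suc r k))))

  count-positive : ∀ t r k τ j → r ≤ j → j < r ℕ.+ k → τ j ≡ t → ∃ λ c → count t r k τ ≡ suc c
  count-positive t r zero    τ j r≤j j<r+0 _ = ⊥-elim (ℕP.<⇒≱ (subst (j <_) (ℕP.+-identityʳ r) j<r+0) r≤j)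
  count-positive t r (suc k) τ j r≤j j< τj≡t with r ℕ.≟ j
  ... | yes refl = count t (suc r) k τ , count-≡ t r k τ τj≡t
  ... | no  r≢j with count-positive t (suc r) k τ j (ℕP.≤∧≢⇒< r≤j r≢j) (subst (j <_) (ℕP.+-suc r k) j<) τj≡t
  ...   | c , count≡ = _ , trans (cong (_ ℕ.+_) count≡) (ℕP.+-suc _ c)

  count-gen+other : ∀ r k τ → NoIdent r k τ → count gen r k τ ℕ.+ count other r k τ ≡ k
  count-gen+other r zero    τ _       = refl
  count-gen+other r (suc k) τ noIdent with gen-or-other (τ r) (NoIdent-head {r} {k} {τ} noIdent)
  ... | inj₁ τr≡gen =
    trans (cong₂ ℕ._+_ (count-≡ gen r k τ τr≡gen) (count-≢ other r k τ (λ e → gen≢other (trans (sym τr≡gen) e))))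
          (cong suc (count-gen+other (suc r) k τ (NoIdent-tail {r} {k} {τ} noIdent)))
  ... | inj₂ τr≡other =
    trans (cong₂ ℕ._+_ (count-≢ gen r k τ (λ e → gen≢other (trans (sym e) τr≡other))) (count-≡ other r k τ τr≡other))
          (trans (ℕP.+-suc _ _) (cong suc (count-gen+other (suc r) k τ (NoIdent-tail {r} {k} {τ} noIdent))))

  Φ-closedForm : ∀ k z {γ ο ℓ} r τ → Taken ℓ γ ο → r ≡ length (withIdent z ℓ) → Lists (withIdent z ℓ) 0 τ →
    NoIdent r k τ → Φ r k τ ≈ closedForm z γ ο (count gen r k τ) (count other r k τ)
  Φ-closedForm zero z {γ} {ο} {ℓ} r τ taken refl lists _ = begin
    Φ (length (withIdent z ℓ)) 0 τ ≈⟨ Φ-listed (withIdent z ℓ) τ lists ⟩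
    negDistDet (withIdent z ℓ)      ≈⟨ negDistDet-taken z taken ⟩
    const (δ z γ ο)                 ≈⟨ ≈-sym (closedForm-zero z γ ο) ⟩
    closedForm z γ ο 0 0            ∎
  Φ-closedForm (suc k) z {γ} {ο} {ℓ} r τ taken r≡ lists noIdent = begin
    a *ₚ Φ r k (deleteAt r τ) +ₚ Φ (suc r) k τ
      ≈⟨ +-cong (*-cong (≈-refl {a}) remaining) (≈-refl {Φ (suc r) k τ}) ⟩
    a *ₚ closedForm z γ ο g h +ₚ Φ (suc r) k τ
      ≈⟨ takeNext (gen-or-other (τ r) (NoIdent-head {r} {k} {τ} noIdent)) ⟩
    closedForm z γ ο (count gen r (suc k) τ) (count other r (suc k) τ) ∎
    where
    g = count gen (suc r) k τ
    h = count other (suc r) k τ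
    ℓ′ = withIdent z ℓ

    remaining : Φ r k (deleteAt r τ) ≈ closedForm z γ ο g h
    remaining = ≈-trans
      (Φ-closedForm k z r (deleteAt r τ) taken r≡ (Lists-deleteAt ℓ′ lists (ℕP.≤-reflexive (sym r≡)))
        (NoIdent-deleteAt {r} {k} {τ} noIdent))
      (≈-reflexive (cong₂ (closedForm z γ ο) (count-deleteAt gen k r τ) (count-deleteAt other k r τ)))

    extends : ∀ t → τ r ≡ t → Lists (withIdent z (ℓ ∷ʳ t)) 0 τ
    extends t τr≡t = subst (λ ℓ″ → Lists ℓ″ 0 τ) (sym (withIdent-∷ʳ z ℓ t))
      (Lists-∷ʳ ℓ′ lists (trans (cong τ (sym r≡)) τr≡t))

    length-extends : ∀ t → suc r ≡ length (withIdent z (ℓ ∷ʳ t))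
    length-extends t = trans (cong suc r≡)
      (trans (sym (LP.length-++-comm ℓ′ (t ∷ []))) (cong length (sym (withIdent-∷ʳ z ℓ t))))

    alreadyTaken : ∀ {t} → t ∈ ℓ → τ r ≡ t → Φ (suc r) k τ ≈ []
    alreadyTaken t∈ℓ τr≡t with Lists-∈ ℓ′ (withIdent-∈ z t∈ℓ) lists
    ... | j , j<ℓ′ , τj≡t = Φ-duplicate k (suc r) τ (subst (j <_) (sym r≡) j<ℓ′) (ℕP.n<1+n r) (trans τj≡t (sym τr≡t))

    takeNext : τ r ≡ gen ⊎ τ r ≡ other →
      a *ₚ closedForm z γ ο g h +ₚ Φ (suc r) k τ ≈ closedForm z γ ο (count gen r (suc k) τ) (count other r (suc k) τ)
    takeNext (inj₁ τr≡gen) = begin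
      a *ₚ closedForm z γ ο g h +ₚ Φ (suc r) k τ
        ≈⟨ +-cong (≈-refl {a *ₚ closedForm z γ ο g h}) (next γ taken) ⟩
      a *ₚ closedForm z γ ο g h +ₚ (if γ then [] else closedForm z true ο g h)
        ≈⟨ ≈-sym (closedForm-suc-gen z γ ο g h) ⟩
      closedForm z γ ο (suc g) h
        ≡⟨ cong₂ (closedForm z γ ο) (sym (count-≡ gen r k τ τr≡gen))
                                    (sym (count-≢ other r k τ (λ e → gen≢other (trans (sym τr≡gen) e)))) ⟩
      closedForm z γ ο (count gen r (suc k) τ) (count other r (suc k) τ) ∎
      where
      next : ∀ γ → Taken ℓ γ ο → Φ (suc r) k τ ≈ (if γ then [] else closedForm z true ο g h)
      next true  taken = alreadyTaken (Taken-gen∈ taken) τr≡gen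
      next false taken = Φ-closedForm k z (suc r) τ (Taken-∷ʳ-gen taken) (length-extends gen) (extends gen τr≡gen)
                                      (NoIdent-tail {r} {k} {τ} noIdent)
    takeNext (inj₂ τr≡other) = begin
      a *ₚ closedForm z γ ο g h +ₚ Φ (suc r) k τ
        ≈⟨ +-cong (≈-refl {a *ₚ closedForm z γ ο g h}) (next ο taken) ⟩
      a *ₚ closedForm z γ ο g h +ₚ (if ο then [] else closedForm z γ true g h)
        ≈⟨ ≈-sym (closedForm-suc-other z γ ο g h) ⟩
      closedForm z γ ο g (suc h)
        ≡⟨ cong₂ (closedForm z γ ο) (sym (count-≢ gen r k τ (λ e → gen≢other (trans (sym e) τr≡other))))
                                    (sym (count-≡ other r k τ τr≡other)) ⟩
      closedForm z γ ο (count gen r (suc k) τ) (count other r (suc k) τ) ∎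
      where
      next : ∀ ο → Taken ℓ γ ο → Φ (suc r) k τ ≈ (if ο then [] else closedForm z γ true g h)
      next true  taken = alreadyTaken (Taken-other∈ taken) τr≡other
      next false taken = Φ-closedForm k z (suc r) τ (Taken-∷ʳ-other taken) (length-extends other) (extends other τr≡other)
                                      (NoIdent-tail {r} {k} {τ} noIdent)

  ^ₚ-+ : ∀ p m n → p ^ₚ (m ℕ.+ n) ≈ p ^ₚ m *ₚ p ^ₚ n
  ^ₚ-+ p zero    n = ≈-sym (*-identityˡ (p ^ₚ n))
  ^ₚ-+ p (suc m) n = ≈-trans (*-cong (≈-refl {p}) (^ₚ-+ p m n)) (≈-sym (*-assoc p (p ^ₚ m) (p ^ₚ n)))

  charPoly : ℕ → ℕ → Poly
  charPoly n φ =
    ((X +ₚ const (+ 1)) ^ₚ (n ℕ.∸ 3))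
      *ₚ ( (X ^ₚ 3)
         +ₚ (const (+ 3 ℤ.- + n) *ₚ (X ^ₚ 2))
         +ₚ (const (+ 3 ℤ.- + 2 ℤ.* + n ℤ.- + 3 ℤ.* + φ) *ₚ X)
         +ₚ const (ℤ.- (+ φ ℤ.* + φ) ℤ.- + φ ℤ.* (+ 4 ℤ.- + n) ℤ.- + n ℤ.+ + 1) )

  -- The constant coefficients of charPoly as polynomial expressions in n and φ, for the ring solver.
  charPoly-constants : ∀ n φ → charPoly n φ ≈
    a ^ₚ (n ℕ.∸ 3)
      *ₚ ( (X ^ₚ 3)
         +ₚ (const (+ 3) -ₚ const (+ n)) *ₚ (X ^ₚ 2)
         +ₚ ((const (+ 3) -ₚ const (+ 2) *ₚ const (+ n)) -ₚ const (+ 3) *ₚ const (+ φ)) *ₚ X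
         +ₚ ((((-ₚ (const (+ φ) *ₚ const (+ φ))) -ₚ const (+ φ) *ₚ (const (+ 4) -ₚ const (+ n))) -ₚ const (+ n)) +ₚ const (+ 1)) )
  charPoly-constants n φ = *-cong (≈-refl {a ^ₚ (n ℕ.∸ 3)}) (+-cong
    (+-cong (≈-refl {X ^ₚ 3 +ₚ (const (+ 3 ℤ.- + n) *ₚ (X ^ₚ 2))})
      (*-cong (+-cong (+-cong (≈-refl {const (+ 3)}) (neg-cong (const-* (+ 2) (+ n)))) (neg-cong (const-* (+ 3) (+ φ))))
              (≈-refl {X})))
    (+-cong (+-cong (+-cong (neg-cong (const-* (+ φ) (+ φ)))
                            (neg-cong (const-* (+ φ) (+ 4 ℤ.- + n))))
                    (≈-refl { -ₚ const (+ n)}))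
            (≈-refl {const (+ 1)})))

  closedForm-charPoly : ∀ g h →
    a *ₚ closedForm false false false (suc g) (suc h) +ₚ closedForm true false false (suc g) (suc h)
      ≈ charPoly (3 ℕ.+ g ℕ.+ h) (suc g)
  closedForm-charPoly g h =
    ≈-trans (+-cong (*-cong (≈-refl {a}) (bilinear-cong (δ false) block-g block-h)) (bilinear-cong (δ true) block-g block-h))
      (≈-trans (solve 5 (λ x P Q G H →
          let A = x :+ con (+ 1)
              N = con (+ 3) :+ G :+ H
              F = con (+ 1) :+ G
              Gᵢ = (con (+ 1) :+ G) :* P
              Hᵢ = (con (+ 1) :+ H) :* Q
          in A :* (con (+ 1) :* ((A :* P) :* (A :* Q)) :+ con -[1+ 0 ] :* ((A :* P) :* Hᵢ)
                   :+ con -[1+ 0 ] :* (Gᵢ :* (A :* Q)) :+ con (+ 0) :* (Gᵢ :* Hᵢ))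
             :+ (con -[1+ 0 ] :* ((A :* P) :* (A :* Q)) :+ con (+ 0) :* ((A :* P) :* Hᵢ)
                 :+ con -[1+ 2 ] :* (Gᵢ :* (A :* Q)) :+ con (+ 1) :* (Gᵢ :* Hᵢ))
          := (P :* Q) :* (x :* (x :* (x :* con (+ 1)))
                          :+ (con (+ 3) :- N) :* (x :* (x :* con (+ 1)))
                          :+ ((con (+ 3) :- con (+ 2) :* N) :- con (+ 3) :* F) :* x
                          :+ ((((:- (F :* F)) :- F :* (con (+ 4) :- N)) :- N) :+ con (+ 1))))
        ≈-refl X (a ^ₚ g) (a ^ₚ h) (const (+ g)) (const (+ h)))
      (≈-trans (*-cong (≈-sym (^ₚ-+ a g h)) ≈-refl) (≈-sym (charPoly-constants (3 ℕ.+ g ℕ.+ h) (suc g)))))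
    where
    block-g : ∀ c → block false c (suc g) ≈ (if c then const (+ suc g) *ₚ a ^ₚ g else a *ₚ a ^ₚ g)
    block-g false = ≈-refl
    block-g true  = derivPow-suc g
    block-h : ∀ c → block false c (suc h) ≈ (if c then const (+ suc h) *ₚ a ^ₚ h else a *ₚ a ^ₚ h)
    block-h false = ≈-refl
    block-h true  = derivPow-suc h

module StrongPowerGraph (n : ℕ) (composite : Composite n) (d : Fin n → Fin n → ℕ)
                        (isDistance : IsDistance (StrongPowerAdj n) d) where

  open Polynomial
  open ThreeKinds
  open import Data.Nat as ℕ using (ℕ; zero; suc; _<_; _≤_; s≤s; z≤n)
  import Data.Nat.Properties as ℕP
  open import Data.Nat.Base using (nonTrivial⇒n>1)
  open import Data.Nat.Divisibility using (_∣_; divides; _∣0; ∣⇒≤; ∣-antisym; ∣-refl)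
  open import Data.Nat.Divisibility.Core using (hasNonTrivialDivisor)
  open import Data.Nat.GCD using (gcd; gcd[m,n]∣m; gcd[m,n]∣n; gcd-greatest; gcd[m,n]≢0; gcd-identityˡ; gcd-zeroˡ)
  open import Data.Nat.Coprimality using (gcd≡1⇒coprime; coprime-divisor)
  import Data.Nat.Coprimality as Coprime
  open import Data.Integer as ℤ using (+_; -_)
  import Data.Integer.Properties as ℤP
  open import Data.Fin as F using (Fin; toℕ)
  import Data.Fin.Properties as FP
  open import Data.Product using (∃; _×_; _,_; proj₁; proj₂)
  open import Data.Sum using (inj₁)
  open import Data.Empty using (⊥-elim)
  open import Data.Unit using (tt)
  open import Function using (_∘_)
  open import Relation.Nullary using (Dec; yes; no; ¬_; does)
  open import Relation.Nullary.Decidable using (⌊_⌋)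
  open import Data.Bool using (true; false; if_then_else_)
  open import Data.List using ([]; _∷_; length; filter; applyUpTo)
  import Data.List.Properties as LP
  open import Relation.Binary.PropositionalEquality using (_≡_; _≢_; refl; sym; trans; cong; cong₂; subst)

  Adj : Fin n → Fin n → Set
  Adj = StrongPowerAdj n

  properDivisor : ∃ λ p → 1 < p × p < n × p ∣ n
  properDivisor = divisorOf composite
    where
    divisorOf : Composite n → ∃ λ p → 1 < p × p < n × p ∣ n
    divisorOf (hasNonTrivialDivisor {p} {{nontrivial}} p<n p∣n) = p , nonTrivial⇒n>1 p {{nontrivial}} , p<n , p∣n

  p : ℕ
  p = proj₁ properDivisor

  1<p : 1 < p
  1<p = proj₁ (proj₂ properDivisor)

  p<n : p < n
  p<n = proj₁ (proj₂ (proj₂ properDivisor))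

  p∣n : p ∣ n
  p∣n = proj₂ (proj₂ (proj₂ properDivisor))

  1<n : 1 < n
  1<n = ℕP.<-trans 1<p p<n

  n≢0 : n ≢ 0
  n≢0 refl = ℕP.<-asym 1<n (s≤s z≤n)

  gcd[n,n]≢1 : gcd n n ≢ 1
  gcd[n,n]≢1 e = ℕP.<-irrefl (trans (sym e) (∣-antisym (gcd[m,n]∣m n n) (gcd-greatest ∣-refl ∣-refl))) 1<n

  annihilator : ∀ y → y ≢ 0 → gcd y n ≢ 1 → ∃ λ q → 1 ≤ q × q < n × n ∣ q ℕ.* y
  annihilator y y≢0 gcd≢1 with gcd[m,n]∣n y n | gcd[m,n]∣m y n
  ... | divides q n≡qg | divides t y≡tg = q , 1≤q , q<n , divides t qy≡tn
    where
    g = gcd y n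
    2≤g : 2 ≤ g
    2≤g = ℕP.≤∧≢⇒< (ℕP.n≢0⇒n>0 (gcd[m,n]≢0 y n (inj₁ y≢0))) (gcd≢1 ∘ sym)
    1≤q : 1 ≤ q
    1≤q = ℕP.n≢0⇒n>0 λ q≡0 → n≢0 (trans n≡qg (cong (ℕ._* g) q≡0))
    q<n : q < n
    q<n = subst (q <_) (sym n≡qg) (ℕP.m<m*n q g {{ℕ.>-nonZero 1≤q}} 2≤g)
    qy≡tn : q ℕ.* y ≡ t ℕ.* n
    qy≡tn = trans (cong (q ℕ.*_) y≡tg) (trans (sym (ℕP.*-assoc q t g))
      (trans (cong (ℕ._* g) (ℕP.*-comm q t)) (trans (ℕP.*-assoc t q g) (cong (t ℕ.*_) (sym n≡qg)))))

  no-annihilator : ∀ m y → 1 ≤ m → m < n → gcd y n ≡ 1 → ¬ (n ∣ m ℕ.* y)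
  no-annihilator m y 1≤m m<n gcd≡1 n∣my = ℕP.<⇒≱ m<n
    (∣⇒≤ {{ℕ.>-nonZero 1≤m}} (coprime-divisor (Coprime.sym (gcd≡1⇒coprime {y} {n} gcd≡1))
                                              (subst (n ∣_) (ℕP.*-comm m y) n∣my)))

  ∣+m-+n∣-comm : ∀ a b → ℤ.∣ + a ℤ.- + b ∣ ≡ ℤ.∣ + b ℤ.- + a ∣
  ∣+m-+n∣-comm a b = trans (cong ℤ.∣_∣ (ℤP.m-n≡m⊖n a b))
    (trans (ℤP.∣m⊖n∣≡∣n⊖m∣ a b) (cong ℤ.∣_∣ (sym (ℤP.m-n≡m⊖n b a))))

  adjacent-sym : ∀ {x y} → Adj x y → Adj y x
  adjacent-sym {x} {y} (x≢y , n₁ , n₂ , 1≤n₁ , n₁<n , 1≤n₂ , n₂<n , n∣) =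
    x≢y ∘ sym , n₂ , n₁ , 1≤n₂ , n₂<n , 1≤n₁ , n₁<n , subst (n ∣_) (∣+m-+n∣-comm (n₁ ℕ.* toℕ x) (n₂ ℕ.* toℕ y)) n∣

  adjacent-nonzero : ∀ x y → toℕ x ≢ 0 → toℕ y ≢ 0 → x ≢ y → Adj x y
  adjacent-nonzero x y x≢0 y≢0 x≢y =
    x≢y , toℕ y , toℕ x , ℕP.n≢0⇒n>0 y≢0 , FP.toℕ<n y , ℕP.n≢0⇒n>0 x≢0 , FP.toℕ<n x ,
    subst (λ z → n ∣ ℤ.∣ + z ℤ.- + (toℕ x ℕ.* toℕ y) ∣) (ℕP.*-comm (toℕ x) (toℕ y))
      (subst (λ z → n ∣ ℤ.∣ z ∣) (sym (ℤP.+-inverseʳ (+ (toℕ x ℕ.* toℕ y)))) (n ∣0))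

  adjacent-zero-nonGenerator : ∀ x y → toℕ x ≡ 0 → toℕ y ≢ 0 → gcd (toℕ y) n ≢ 1 → Adj x y
  adjacent-zero-nonGenerator x y x≡0 y≢0 gcd≢1 with annihilator (toℕ y) y≢0 gcd≢1
  ... | q , 1≤q , q<n , n∣qy =
    (λ x≡y → y≢0 (trans (cong toℕ (sym x≡y)) x≡0)) , 1 , q , s≤s z≤n , 1<n , 1≤q , q<n ,
    subst (λ z → n ∣ ℤ.∣ + (1 ℕ.* z) ℤ.- + (q ℕ.* toℕ y) ∣) (sym x≡0)
      (subst (n ∣_) (trans (sym (ℤP.∣-i∣≡∣i∣ (+ (q ℕ.* toℕ y)))) (cong ℤ.∣_∣ (sym (ℤP.+-identityˡ (- + (q ℕ.* toℕ y)))))) n∣qy)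

  nonadjacent-zero-generator : ∀ x y → toℕ x ≡ 0 → gcd (toℕ y) n ≡ 1 → ¬ Adj x y
  nonadjacent-zero-generator x y x≡0 gcd≡1 (_ , n₁ , n₂ , _ , _ , 1≤n₂ , n₂<n , n∣) =
    no-annihilator n₂ (toℕ y) 1≤n₂ n₂<n gcd≡1 (subst (n ∣_) ∣0-n₂y∣≡n₂y n∣)
    where
    ∣0-n₂y∣≡n₂y : ℤ.∣ + (n₁ ℕ.* toℕ x) ℤ.- + (n₂ ℕ.* toℕ y) ∣ ≡ n₂ ℕ.* toℕ y
    ∣0-n₂y∣≡n₂y = trans (cong (λ z → ℤ.∣ + (n₁ ℕ.* z) ℤ.- + (n₂ ℕ.* toℕ y) ∣) x≡0)
      (trans (cong (λ z → ℤ.∣ + z ℤ.- + (n₂ ℕ.* toℕ y) ∣) (ℕP.*-zeroʳ n₁))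
        (trans (cong ℤ.∣_∣ (ℤP.+-identityˡ (- + (n₂ ℕ.* toℕ y)))) (ℤP.∣-i∣≡∣i∣ (+ (n₂ ℕ.* toℕ y)))))

  distance-self : ∀ i → d i i ≡ 0
  distance-self i = ℕP.n≤0⇒n≡0 (proj₂ (isDistance i i) 0 here)

  distance-adjacent : ∀ {i j} → Adj i j → d i j ≡ 1
  distance-adjacent {i} {j} i~j with d i j | proj₁ (isDistance i j) | proj₂ (isDistance i j) 1 (step i~j here)
  ... | zero        | here | _ = ⊥-elim (proj₁ i~j refl)
  ... | suc zero    | _    | _ = refl
  ... | suc (suc _) | _    | s≤s ()

  distance-two : ∀ {i j} w → i ≢ j → ¬ Adj i j → Adj i w → Adj w j → d i j ≡ 2
  distance-two {i} {j} w i≢j i≁j i~w w~j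
    with d i j | proj₁ (isDistance i j) | proj₂ (isDistance i j) 2 (step i~w (step w~j here))
  ... | zero              | here              | _ = ⊥-elim (i≢j refl)
  ... | suc zero          | step i~j here     | _ = ⊥-elim (i≁j i~j)
  ... | suc (suc zero)    | _                 | _ = refl
  ... | suc (suc (suc _)) | _                 | s≤s (s≤s ())

  coprimeKind : ∀ {A : Set} → Dec A → Kind
  coprimeKind (yes _) = gen
  coprimeKind (no _)  = other

  kindOf : ℕ → Kind
  kindOf zero    = ident
  kindOf (suc m) = coprimeKind (gcd (suc m) n ℕ.≟ 1)

  data Classified (v : Fin n) : Kind → Set where
    identity     : toℕ v ≡ 0 → Classified v ident
    generator    : gcd (toℕ v) n ≡ 1 → Classified v gen
    nonGenerator : toℕ v ≢ 0 → gcd (toℕ v) n ≢ 1 → Classified v other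

  classify : ∀ v → Classified v (kindOf (toℕ v))
  classify v with toℕ v in v≡
  ... | zero  = identity v≡
  ... | suc m with gcd (suc m) n ℕ.≟ 1
  ...   | yes coprime = generator (trans (cong (λ z → gcd z n) v≡) coprime)
  ...   | no ¬coprime = nonGenerator (λ v≡0 → ℕP.0≢1+n (trans (sym v≡0) v≡))
                                     (λ coprime → ¬coprime (trans (cong (λ z → gcd z n) (sym v≡)) coprime))

  generator≢0 : ∀ (v : Fin n) → gcd (toℕ v) n ≡ 1 → toℕ v ≢ 0
  generator≢0 v coprime v≡0 = ℕP.<-irrefl (trans (sym coprime) (trans (cong (λ z → gcd z n) v≡0) (gcd-identityˡ n))) 1<n

  pᶠ : Fin n
  pᶠ = F.fromℕ< p<n

  p≢0 : p ≢ 0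
  p≢0 p≡0 = ℕP.<-asym 1<p (subst (_< 1) (sym p≡0) (s≤s z≤n))

  gcd[p,n]≢1 : gcd p n ≢ 1
  gcd[p,n]≢1 coprime = ℕP.<-irrefl (trans (sym coprime) (∣-antisym (gcd[m,n]∣m p n) (gcd-greatest ∣-refl p∣n))) 1<p

  pᶠ-nonGenerator : Classified pᶠ other
  pᶠ-nonGenerator = nonGenerator (p≢0 ∘ trans (sym toℕ-pᶠ)) (gcd[p,n]≢1 ∘ trans (cong (λ z → gcd z n) (sym toℕ-pᶠ)))
    where
    toℕ-pᶠ : toℕ pᶠ ≡ p
    toℕ-pᶠ = FP.toℕ-fromℕ< p<n

  negDist-distance : ∀ {i j s t} → i ≢ j → Classified i s → Classified j t → - (+ d i j) ≡ negDist s t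
  negDist-distance i≢j (identity i≡0) (identity j≡0) = ⊥-elim (i≢j (FP.toℕ-injective (trans i≡0 (sym j≡0))))
  negDist-distance {i} {j} i≢j (identity i≡0) (generator coprime) with pᶠ-nonGenerator
  ... | nonGenerator p≢0 p-noncoprime = cong (λ z → - (+ z)) (distance-two pᶠ i≢j
    (nonadjacent-zero-generator i j i≡0 coprime) (adjacent-zero-nonGenerator i pᶠ i≡0 p≢0 p-noncoprime)
    (adjacent-nonzero pᶠ j p≢0 (generator≢0 j coprime)
      (λ p≡j → p-noncoprime (trans (cong (λ v → gcd (toℕ v) n) p≡j) coprime))))
  negDist-distance {i} {j} i≢j (identity i≡0) (nonGenerator j≢0 noncoprime) =
    cong (λ z → - (+ z)) (distance-adjacent (adjacent-zero-nonGenerator i j i≡0 j≢0 noncoprime))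
  negDist-distance {i} {j} i≢j (generator coprime) (identity j≡0) with pᶠ-nonGenerator
  ... | nonGenerator p≢0 p-noncoprime = cong (λ z → - (+ z)) (distance-two pᶠ i≢j
    (nonadjacent-zero-generator j i j≡0 coprime ∘ adjacent-sym)
    (adjacent-nonzero i pᶠ (generator≢0 i coprime) p≢0
      (λ i≡p → p-noncoprime (trans (cong (λ v → gcd (toℕ v) n) (sym i≡p)) coprime)))
    (adjacent-sym (adjacent-zero-nonGenerator j pᶠ j≡0 p≢0 p-noncoprime)))
  negDist-distance {i} {j} i≢j (nonGenerator i≢0 noncoprime) (identity j≡0) =
    cong (λ z → - (+ z)) (distance-adjacent (adjacent-sym (adjacent-zero-nonGenerator j i j≡0 i≢0 noncoprime)))
  negDist-distance {i} {j} i≢j (generator ci) (generator cj) =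
    cong (λ z → - (+ z)) (distance-adjacent (adjacent-nonzero i j (generator≢0 i ci) (generator≢0 j cj) i≢j))
  negDist-distance {i} {j} i≢j (generator ci) (nonGenerator j≢0 _) =
    cong (λ z → - (+ z)) (distance-adjacent (adjacent-nonzero i j (generator≢0 i ci) j≢0 i≢j))
  negDist-distance {i} {j} i≢j (nonGenerator i≢0 _) (generator cj) =
    cong (λ z → - (+ z)) (distance-adjacent (adjacent-nonzero i j i≢0 (generator≢0 j cj) i≢j))
  negDist-distance {i} {j} i≢j (nonGenerator i≢0 _) (nonGenerator j≢0 _) =
    cong (λ z → - (+ z)) (distance-adjacent (adjacent-nonzero i j i≢0 j≢0 i≢j))

  distanceMatrix-shifted : ∀ i j →
    (if ⌊ i F.≟ j ⌋ then X else []) -ₚ const (+ d i j) ≈ shiftedFrom n 0 kindOf i j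
  distanceMatrix-shifted i j = entry (i F.≟ j)
    where
    diagonal : ∀ t → X -ₚ const (+ 0) ≈ a +ₚ const (negDist t t)
    diagonal ident = ≈-by-trim refl
    diagonal gen   = ≈-by-trim refl
    diagonal other = ≈-by-trim refl
    entry : (i≟j : Dec (i ≡ j)) →
      (if ⌊ i≟j ⌋ then X else []) -ₚ const (+ d i j)
        ≈ (if does i≟j then a else []) +ₚ const (negDist (kindOf (toℕ i)) (kindOf (toℕ j)))
    entry (yes refl) = ≈-trans (≈-reflexive (cong (λ z → X -ₚ const (+ z)) (distance-self i))) (diagonal (kindOf (toℕ i)))
    entry (no i≢j)   = ≈-reflexive (cong (_∷ []) (negDist-distance i≢j (classify i) (classify j)))

  kindOf-coprime : ∀ m → gcd m n ≡ 1 → kindOf m ≡ gen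
  kindOf-coprime zero    coprime = ⊥-elim (ℕP.<-irrefl (trans (sym coprime) (gcd-identityˡ n)) 1<n)
  kindOf-coprime (suc m) coprime with gcd (suc m) n ℕ.≟ 1
  ... | yes _         = refl
  ... | no  ¬coprime  = ⊥-elim (¬coprime coprime)

  kindOf-noncoprime : ∀ m → m ≢ 0 → gcd m n ≢ 1 → kindOf m ≡ other
  kindOf-noncoprime zero    m≢0 _          = ⊥-elim (m≢0 refl)
  kindOf-noncoprime (suc m) _   ¬coprime with gcd (suc m) n ℕ.≟ 1
  ... | yes coprime = ⊥-elim (¬coprime coprime)
  ... | no  _       = refl

  kindOf-gen⇒coprime : ∀ m → kindOf (suc m) ≡ gen → gcd (suc m) n ≡ 1
  kindOf-gen⇒coprime m with gcd (suc m) n ℕ.≟ 1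
  ... | yes coprime = λ _ → coprime
  ... | no  _       = λ ()

  noIdent : ∀ k → NoIdent 1 k kindOf
  noIdent k i _ with gcd (suc i) n ℕ.≟ 1
  ... | yes _ = λ ()
  ... | no  _ = λ ()

  coprime? : ∀ m → Dec (gcd m n ≡ 1)
  coprime? m = gcd m n ℕ.≟ 1

  length-filter-∷ : ∀ {P : ℕ → Set} (P? : ∀ m → Dec (P m)) x xs →
    length (filter P? (x ∷ xs)) ≡ (if does (P? x) then 1 else 0) ℕ.+ length (filter P? xs)
  length-filter-∷ P? x xs with does (P? x)
  ... | true  = refl
  ... | false = refl

  coprimeKind-gen : ∀ {A : Set} (A? : Dec A) → does (coprimeKind A? ≟ᵏ gen) ≡ does A?
  coprimeKind-gen (yes _) = refl
  coprimeKind-gen (no _)  = refl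

  coprimes-count : ∀ k r f → (∀ i → f i ≡ suc (r ℕ.+ i)) →
    length (filter coprime? (applyUpTo f k)) ≡ count gen (suc r) k kindOf
  coprimes-count zero    r f f≡ = refl
  coprimes-count (suc k) r f f≡ = trans (length-filter-∷ coprime? (f 0) (applyUpTo (f ∘ suc) k))
    (cong₂ ℕ._+_
      (cong (if_then 1 else 0) (trans (cong (does ∘ coprime?) (trans (f≡ 0) (cong suc (ℕP.+-identityʳ r))))
                                      (sym (coprimeKind-gen (coprime? (suc r))))))
      (coprimes-count k (suc r) (f ∘ suc) (λ i → trans (f≡ (suc i)) (cong suc (ℕP.+-suc r i)))))

  n′ : ℕ
  n′ = ℕ.pred n

  n≡1+n′ : n ≡ suc n′
  n≡1+n′ = sym (ℕP.suc-pred n {{ℕ.≢-nonZero n≢0}})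

  φ≡count : φ n ≡ count gen 1 n′ kindOf
  φ≡count = trans (cong (length ∘ filter coprime?) (LP.map-upTo suc n))
    (trans (coprimes-count n 0 suc (λ _ → refl))
    (trans (cong (λ m → count gen 1 m kindOf) n≡1+n′)
           (count-last gen 1 n′ kindOf (λ n-is-gen → gcd[n,n]≢1
             (subst (λ m → gcd m n ≡ 1) (sym n≡1+n′) (kindOf-gen⇒coprime n′ n-is-gen))))))

  Φ-kindOf : Φ 0 n kindOf ≈ charPoly n (φ n)
  Φ-kindOf = subst (λ m → Φ 0 m kindOf ≈ charPoly m (φ n)) (sym n≡1+n′) expansion
    where
    open ≈-Reasoning
    g = count gen 1 n′ kindOf
    h = count other 1 n′ kindOf

    withoutIdentity : Φ 0 n′ (deleteAt 0 kindOf) ≈ closedForm false false false g h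
    withoutIdentity = ≈-trans
      (Φ-closedForm n′ false 0 (deleteAt 0 kindOf) ⟨⟩ refl tt
        (λ i i<k → noIdent n′ i i<k ∘ trans (sym (deleteAt-≥ 0 kindOf z≤n))))
      (≈-reflexive (cong₂ (closedForm false false false) (count-deleteAt gen n′ 0 kindOf) (count-deleteAt other n′ 0 kindOf)))

    withIdentity : Φ 1 n′ kindOf ≈ closedForm true false false g h
    withIdentity = Φ-closedForm n′ true 1 kindOf ⟨⟩ refl (refl , tt) (noIdent n′)

    1<1+n′ : 1 < 1 ℕ.+ n′
    1<1+n′ = subst (1 <_) n≡1+n′ 1<n

    p<1+n′ : p < 1 ℕ.+ n′
    p<1+n′ = subst (p <_) n≡1+n′ p<n

    expansion : Φ 0 (suc n′) kindOf ≈ charPoly (suc n′) (φ n)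
    expansion with count-positive gen 1 n′ kindOf 1 ℕP.≤-refl 1<1+n′ (kindOf-coprime 1 (gcd-zeroˡ n))
                 | count-positive other 1 n′ kindOf p (ℕP.<⇒≤ 1<p) p<1+n′ (kindOf-noncoprime p p≢0 gcd[p,n]≢1)
    ... | g₀ , g≡ | h₀ , h≡ = begin
      a *ₚ Φ 0 n′ (deleteAt 0 kindOf) +ₚ Φ 1 n′ kindOf
        ≈⟨ +-cong (*-cong (≈-refl {a}) withoutIdentity) withIdentity ⟩
      a *ₚ closedForm false false false g h +ₚ closedForm true false false g h
        ≡⟨ cong₂ (λ g h → a *ₚ closedForm false false false g h +ₚ closedForm true false false g h) g≡ h≡ ⟩
      a *ₚ closedForm false false false (suc g₀) (suc h₀) +ₚ closedForm true false false (suc g₀) (suc h₀)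
        ≈⟨ closedForm-charPoly g₀ h₀ ⟩
      charPoly (3 ℕ.+ g₀ ℕ.+ h₀) (suc g₀)
        ≡⟨ cong₂ charPoly (sym 1+n′≡3+g₀+h₀) (sym (trans φ≡count g≡)) ⟩
      charPoly (suc n′) (φ n) ∎
      where
      1+n′≡3+g₀+h₀ : suc n′ ≡ 3 ℕ.+ g₀ ℕ.+ h₀
      1+n′≡3+g₀+h₀ = cong suc (trans (sym (count-gen+other 1 n′ kindOf (noIdent n′)))
        (trans (cong₂ ℕ._+_ g≡ h≡) (cong suc (ℕP.+-suc g₀ h₀))))

theorem2p2 : (n : ℕ) → Composite n →
    (d : Fin n → Fin n → ℕ) → IsDistance (StrongPowerAdj n) d →
    distCharPoly n d ≈ₚ
      ((X +ₚ const (+ 1)) ^ₚ (n ∸ 3))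
        *ₚ ( (X ^ₚ 3)
           +ₚ (const (+ 3 - + n) *ₚ (X ^ₚ 2))
           +ₚ (const (+ 3 - + 2 * + n - + 3 * + φ n) *ₚ X)
           +ₚ const (- (+ φ n * + φ n) - + φ n * (+ 4 - + n) - + n + + 1) )
theorem2p2 n composite d isDistance = Polynomial.coeff-≡ (begin
  distCharPoly n d                      ≈⟨ Determinant.det-cong n distanceMatrix-shifted ⟩
  det n (shiftedFrom n 0 kindOf)        ≈⟨ det-shiftedFrom n 0 n kindOf refl ⟩
  Φ 0 n kindOf                          ≈⟨ Φ-kindOf ⟩
  ThreeKinds.charPoly n (φ n)           ∎)
  where
  open Polynomial.≈-Reasoning
  open ThreeKinds using (shiftedFrom; det-shiftedFrom; Φ)
  open StrongPowerGraph n composite d isDistance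
  open import Relation.Binary.PropositionalEquality using (refl)
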